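{- For all $\varepsilon'>0$ and $\delta>0$ there exists $\varepsilon=\varepsilon(\varepsilon',\delta)>0$ such that the following holds for every $p>0$. Let $(V_1,V_2,V_3)$ be an $\varepsilon$-typical $(\varepsilon,p)$-regular triple with minimum density at least $\delta p$, and assume that the endpoints of no edge between $V_2$ and $V_3$ have more than $4p^2|V_1|$ common neighbours in $V_1$. Then $V_1$ contains at most $\varepsilon'|V_1|$ vertices that are not $\varepsilon'$-good.
   Context: $d(X,Y)=e(X,Y)/(|X||Y|)$; write $d(V_i,V_j)=d_{ij}p$ and $\{i,j,k\}=\{1,2,3\}$; minimum density is $\min d(V_i,V_j)$. A pair $(A,B)$ is $(\varepsilon,p)$-regular if $|d(A,B)-d(A',B')|\le\varepsilon p$ for all $A'\subset A$, $B'\subset B$ with $|A'|\ge\varepsilon|A|$, $|B'|\ge\varepsilon|B|$; a triple is $(\varepsilon,p)$-regular if all pairs are. A vertex $v\in V_i$ is $\varepsilon$-typical if, with $N_l=N(v)\cap V_l$ ($l\in\{j,k\}$): $(1-\varepsilon)d_{il}p|V_l|\le|N_l|\le(1+\varepsilon)d_{il}p|V_l|$, and there are $N_l'\subset N_l$ with $|N_l'|\ge(1-\varepsilon)|N_l|$ and $(N_j',N_k')$ $(\varepsilon,p)$-regular of density between $(1-\varepsilon)d_{jk}p$ and $(1+\varepsilon)d_{jk}p$. The triple is $\varepsilon$-typical if it is $(\varepsilon,p)$-regular and for each $i$ all but at most $\varepsilon|V_i|$ vertices of $V_i$ are $\varepsilon$-typical. An edge between $V_j$ and $V_k$ is $\varepsilon'$-good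 if its endpoints have at least $(1-\varepsilon')d_{ij}d_{ik}p^2|V_i|$ common neighbours in $V_i$. A vertex $v\in V_i$ is $\varepsilon'$-good if it is $\varepsilon'$-typical and $(N(v)\cap V_j,N(v)\cap V_k)$ contains at most $\varepsilon'd_{12}d_{13}d_{23}p^3|V_j||V_k|$ edges that are not $\varepsilon'$-good.
   Formalization: The parameters ε', δ and p range over the positive rationals, and the witness ε is taken rational. -}

module Defs where

open import Data.Bool using (Bool; true; false; _∧_; not)
open import Data.Nat as ℕ using (ℕ; zero; suc)
open import Data.Fin using (Fin)
open import Data.Fin.Subset using (Subset; _∈_; _∉_; _⊆_; _∩_; ∣_∣)
open import Data.Vec using (tabulate; lookup)
open import Data.Integer using (+_)
open import Data.Rational using (ℚ; 0ℚ; 1ℚ; _/_; _+_; _-_; _*_; _≤_) renaming (∣_∣ to absℚ)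
open import Data.Rational.Properties using (_≤?_)
open import Data.Product using (Σ; _×_)
open import Data.Empty using (⊥)
open import Relation.Nullary using (does)
open import Relation.Binary.PropositionalEquality using (_≡_)

record Graph (n : ℕ) : Set where
  field
    adj    : Fin n → Fin n → Bool
    sym    : ∀ x y → adj x y ≡ adj y x
    irrefl : ∀ x → adj x x ≡ false
open Graph public

sumFin : ∀ {n} → (Fin n → ℕ) → ℕ
sumFin {zero}  f = 0
sumFin {suc n} f = f Fin.zero ℕ.+ sumFin (λ i → f (Fin.suc i))

ind : Bool → ℕ
ind true  = 1
ind false = 0

toℚ : ℕ → ℚ
toℚ k = + k / 1

N : ∀ {n} → Graph n → Fin n → Subset n
N G v = tabulate (adj G v)

e : ∀ {n} → Graph n → Subset n → Subset n → ℕ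
e G X Y = sumFin λ x → sumFin λ y → ind (lookup X x ∧ (lookup Y y ∧ adj G x y))

divℚ : ℕ → ℕ → ℚ
divℚ a zero    = 0ℚ
divℚ a (suc m) = + a / suc m

-- d(X,Y) = e(X,Y)/(|X||Y|)   (convention: 0 if X or Y is empty)
d : ∀ {n} → Graph n → Subset n → Subset n → ℚ
d G X Y = divℚ (e G X Y) (∣ X ∣ ℕ.* ∣ Y ∣)

Disjoint : ∀ {n} → Subset n → Subset n → Set
Disjoint A B = ∀ x → x ∈ A → x ∈ B → ⊥

Regular : ∀ {n} → Graph n → ℚ → ℚ → Subset n → Subset n → Set
Regular {n} G ε p A B = ∀ (A' B' : Subset n) → A' ⊆ A → B' ⊆ B →
  ε * toℚ ∣ A ∣ ≤ toℚ ∣ A' ∣ → ε * toℚ ∣ B ∣ ≤ toℚ ∣ B' ∣ →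
  absℚ (d G A B - d G A' B') ≤ ε * p

RegularTriple : ∀ {n} → Graph n → ℚ → ℚ → Subset n → Subset n → Subset n → Set
RegularTriple G ε p V₁ V₂ V₃ = Regular G ε p V₁ V₂ × Regular G ε p V₁ V₃ × Regular G ε p V₂ V₃

AllButAtMost : ∀ {n} → ℚ → Subset n → (Fin n → Set) → Set
AllButAtMost {n} ε A P = Σ (Subset n) λ B → B ⊆ A × toℚ ∣ B ∣ ≤ ε * toℚ ∣ A ∣ ×
  (∀ v → v ∈ A → v ∉ B → P v)

DegOK : ∀ {n} → Graph n → ℚ → Subset n → Subset n → Fin n → Set
DegOK G ε Vᵢ Vₗ v =
  (1ℚ - ε) * d G Vᵢ Vₗ * toℚ ∣ Vₗ ∣ ≤ toℚ ∣ N G v ∩ Vₗ ∣ ×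
  toℚ ∣ N G v ∩ Vₗ ∣ ≤ (1ℚ + ε) * d G Vᵢ Vₗ * toℚ ∣ Vₗ ∣

-- v ∈ Vᵢ is ε-typical, where {Vⱼ,Vₖ} are the other two classes
-- (note d_{il} p = d(Vᵢ,Vₗ), d_{jk} p = d(Vⱼ,Vₖ))
TypicalVertex : ∀ {n} → Graph n → ℚ → ℚ → Subset n → Subset n → Subset n → Fin n → Set
TypicalVertex {n} G ε p Vᵢ Vⱼ Vₖ v =
  DegOK G ε Vᵢ Vⱼ v × DegOK G ε Vᵢ Vₖ v ×
  Σ (Subset n) λ Nⱼ' → Σ (Subset n) λ Nₖ' →
    Nⱼ' ⊆ (N G v ∩ Vⱼ) × Nₖ' ⊆ (N G v ∩ Vₖ) ×
    (1ℚ - ε) * toℚ ∣ N G v ∩ Vⱼ ∣ ≤ toℚ ∣ Nⱼ' ∣ ×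
    (1ℚ - ε) * toℚ ∣ N G v ∩ Vₖ ∣ ≤ toℚ ∣ Nₖ' ∣ ×
    Regular G ε p Nⱼ' Nₖ' ×
    (1ℚ - ε) * d G Vⱼ Vₖ ≤ d G Nⱼ' Nₖ' ×
    d G Nⱼ' Nₖ' ≤ (1ℚ + ε) * d G Vⱼ Vₖ

TypicalTriple : ∀ {n} → Graph n → ℚ → ℚ → Subset n → Subset n → Subset n → Set
TypicalTriple G ε p V₁ V₂ V₃ =
  RegularTriple G ε p V₁ V₂ V₃ ×
  AllButAtMost ε V₁ (TypicalVertex G ε p V₁ V₂ V₃) ×
  AllButAtMost ε V₂ (TypicalVertex G ε p V₂ V₁ V₃) ×
  AllButAtMost ε V₃ (TypicalVertex G ε p V₃ V₁ V₂)

MinDensityAtLeast : ∀ {n} → Graph n → ℚ → Subset n → Subset n → Subset n → Set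
MinDensityAtLeast G c V₁ V₂ V₃ = c ≤ d G V₁ V₂ × c ≤ d G V₁ V₃ × c ≤ d G V₂ V₃

common : ∀ {n} → Graph n → Fin n → Fin n → Subset n → ℕ
common G x y A = ∣ N G x ∩ (N G y ∩ A) ∣

-- an edge xy between Vⱼ and Vₖ is ε'-good (w.r.t. the third class Vᵢ)
-- d_{ij} d_{ik} p² |Vᵢ| = d(Vᵢ,Vⱼ) d(Vᵢ,Vₖ) |Vᵢ|
goodEdge? : ∀ {n} → Graph n → ℚ → Subset n → Subset n → Subset n → Fin n → Fin n → Bool
goodEdge? G ε' Vᵢ Vⱼ Vₖ x y =
  does ((1ℚ - ε') * d G Vᵢ Vⱼ * d G Vᵢ Vₖ * toℚ ∣ Vᵢ ∣ ≤? toℚ (common G x y Vᵢ))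

badEdges : ∀ {n} → Graph n → ℚ → Subset n → Subset n → Subset n → Subset n → Subset n → ℕ
badEdges G ε' Vᵢ Vⱼ Vₖ X Y = sumFin λ x → sumFin λ y →
  ind (lookup X x ∧ (lookup Y y ∧ (adj G x y ∧ not (goodEdge? G ε' Vᵢ Vⱼ Vₖ x y))))

GoodVertex : ∀ {n} → Graph n → ℚ → ℚ → Subset n → Subset n → Subset n → Fin n → Set
GoodVertex G ε' p Vᵢ Vⱼ Vₖ v =
  TypicalVertex G ε' p Vᵢ Vⱼ Vₖ v ×
  toℚ (badEdges G ε' Vᵢ Vⱼ Vₖ (N G v ∩ Vⱼ) (N G v ∩ Vₖ))
    ≤ ε' * (d G Vᵢ Vⱼ * d G Vᵢ Vₖ * d G Vⱼ Vₖ) * toℚ ∣ Vⱼ ∣ * toℚ ∣ Vₖ ∣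

NoHeavyEdge : ∀ {n} → Graph n → ℚ → Subset n → Subset n → Subset n → Set
NoHeavyEdge G c V₁ V₂ V₃ = ∀ x y → x ∈ V₂ → y ∈ V₃ → adj G x y ≡ true →
  toℚ (common G x y V₁) ≤ c * toℚ ∣ V₁ ∣

-- Write dᵢⱼ for the density d(Vᵢ, Vⱼ) and call an edge xy of (V₂, V₃) bad if x and y have fewer than
-- (1 - ε') d₁₂ d₁₃ |V₁| common neighbours in V₁. For a typical x ∈ V₂ the neighbourhoods A' ⊆ V₁ and
-- C' ⊆ V₃ form a dense regular pair; a set L ⊆ C' of more than ε|C'| bad partners of x would then
-- receive about d₁₃ |A'| |L| ≈ d₁₂ d₁₃ |V₁| |L| edges from A', although each y ∈ L has fewer than
-- (1 - ε') d₁₂ d₁₃ |V₁| neighbours in A' ⊆ N(x) ∩ V₁. So typical vertices have O(ε) d₂₃ |V₃| bad edges,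
-- and regularity bounds the edges at the few atypical ones: there are O(ε) d₂₃ |V₂| |V₃| bad edges.
-- Since every edge has at most 4p² |V₁| common neighbours, double counting gives
-- Σ_{v ∈ V₁} #(bad edges inside N(v)) ≤ 4p² |V₁| · O(ε) d₂₃ |V₂| |V₃|, and by Markov's inequality only
-- (ε' - ε)|V₁| vertices v ∈ V₁ exceed the bound ε' d₁₂ d₁₃ d₂₃ |V₂| |V₃| allowed for good vertices,
-- because d₁₂, d₁₃ ≥ δp and ε is tiny compared with ε'² δ². Together with the at most ε|V₁|
-- atypical vertices of V₁ they form the exceptional set.

module Submission where

open import Defs renaming (sym to adj-sym)
open import Level using (0ℓ)
open import Data.Bool using (Bool; true; false; _∧_; not)
import Data.Bool.Properties as BoolP
open import Data.Empty using (⊥; ⊥-elim)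
open import Function using (_∘_)
open import Data.Nat as ℕ using (ℕ; zero; suc; z≤n; s≤s)
import Data.Nat.Properties as ℕP
import Data.Nat.Tactic.RingSolver as ℕSolver
open import Data.Fin as F using (Fin)
import Data.Fin.Subset.Properties as SubsetP
open import Data.Fin.Subset using (Subset; _∈_; _∉_; _⊆_; _∩_; _∪_; _─_; ∣_∣; inside; outside)
open import Data.Vec as Vec using (_∷_; []; lookup; tabulate)
import Data.Vec.Properties as VecP
open import Data.Integer as ℤ using (+_)
import Data.Integer.Properties as ℤP
open import Data.Rational as ℚ using (ℚ; 0ℚ; 1ℚ; _<_; _≤_; _+_; _-_; _*_; -_; _/_; _⊓_) renaming (∣_∣ to absℚ)
import Data.Rational.Properties as ℚP
import Data.Rational.Unnormalised as ℚᵘ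
import Data.Rational.Unnormalised.Properties as ℚᵘP
open import Data.Product using (Σ; _×_; _,_; proj₁; proj₂)
open import Data.Sum using (inj₁; inj₂; [_,_])
open import Relation.Nullary.Decidable using (Dec; yes; no; does; dec⇒maybe)
open import Relation.Binary.PropositionalEquality using (_≡_; refl; sym; trans; cong; cong₂; subst; module ≡-Reasoning)
open import Tactic.RingSolver using (solve-∀)
open import Tactic.RingSolver.Core.AlmostCommutativeRing using (AlmostCommutativeRing; fromCommutativeRing)

-- Arithmetic on ℚ

ℚ-ring : AlmostCommutativeRing 0ℓ 0ℓ
ℚ-ring = fromCommutativeRing ℚP.+-*-commutativeRing (λ x → dec⇒maybe (0ℚ ℚP.≟ x))

p≤q⇒0≤q-p : ∀ {p q} → p ≤ q → 0ℚ ≤ q - p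
p≤q⇒0≤q-p {p} p≤q = ℚP.≤-trans (ℚP.≤-reflexive (sym (ℚP.+-inverseʳ p))) (ℚP.+-monoˡ-≤ (- p) p≤q)

p<q⇒0<q-p : ∀ {p q} → p < q → 0ℚ < q - p
p<q⇒0<q-p {p} p<q = ℚP.≤-<-trans (ℚP.≤-reflexive (sym (ℚP.+-inverseʳ p))) (ℚP.+-monoˡ-< (- p) p<q)

q-p+p≡q : ∀ p q → q - p + p ≡ q
q-p+p≡q = solve-∀ ℚ-ring

≤-by-difference : ∀ {p q} t → q - p ≡ t → 0ℚ ≤ t → p ≤ q
≤-by-difference {p} {q} t q-p≡t 0≤t = ℚP.≤-trans (ℚP.≤-reflexive (sym (ℚP.+-identityˡ p)))
  (ℚP.≤-trans (ℚP.+-monoˡ-≤ p (subst (0ℚ ≤_) (sym q-p≡t) 0≤t)) (ℚP.≤-reflexive (q-p+p≡q p q)))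

<-by-difference : ∀ {p q} t → q - p ≡ t → 0ℚ < t → p < q
<-by-difference {p} {q} t q-p≡t 0<t = ℚP.≤-<-trans (ℚP.≤-reflexive (sym (ℚP.+-identityˡ p)))
  (ℚP.<-≤-trans (ℚP.+-monoˡ-< p (subst (0ℚ <_) (sym q-p≡t) 0<t)) (ℚP.≤-reflexive (q-p+p≡q p q)))

0≤+ : ∀ {p q} → 0ℚ ≤ p → 0ℚ ≤ q → 0ℚ ≤ p + q
0≤+ = ℚP.+-mono-≤

*-monoˡ-≤ : ∀ {r p q} → 0ℚ ≤ r → p ≤ q → r * p ≤ r * q
*-monoˡ-≤ {r} 0≤r = ℚP.*-monoˡ-≤-nonNeg r {{ℚ.nonNegative 0≤r}}

*-monoʳ-≤ : ∀ {r p q} → 0ℚ ≤ r → p ≤ q → p * r ≤ q * r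
*-monoʳ-≤ {r} 0≤r = ℚP.*-monoʳ-≤-nonNeg r {{ℚ.nonNegative 0≤r}}

*-mono-≤ : ∀ {p q r s} → 0ℚ ≤ p → 0ℚ ≤ s → p ≤ q → r ≤ s → p * r ≤ q * s
*-mono-≤ 0≤p 0≤s p≤q r≤s = ℚP.≤-trans (*-monoˡ-≤ 0≤p r≤s) (*-monoʳ-≤ 0≤s p≤q)

*-cancelʳ-≤ : ∀ {r p q} → 0ℚ < r → p * r ≤ q * r → p ≤ q
*-cancelʳ-≤ {r} 0<r = ℚP.*-cancelʳ-≤-pos r {{ℚ.positive 0<r}}

0≤* : ∀ {p q} → 0ℚ ≤ p → 0ℚ ≤ q → 0ℚ ≤ p * q
0≤* {p} 0≤p 0≤q = ℚP.≤-trans (ℚP.≤-reflexive (sym (ℚP.*-zeroʳ p))) (*-monoˡ-≤ 0≤p 0≤q)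

0<* : ∀ {p q} → 0ℚ < p → 0ℚ < q → 0ℚ < p * q
0<* {p} {q} 0<p 0<q = ℚP.positive⁻¹ (p * q) {{ℚP.pos*pos⇒pos p {{ℚ.positive 0<p}} q {{ℚ.positive 0<q}}}}

p≤∣p∣ : ∀ p → p ≤ absℚ p
p≤∣p∣ p with ℚP.∣p∣≡p∨∣p∣≡-p p
... | inj₁ ∣p∣≡p = ℚP.≤-reflexive (sym ∣p∣≡p)
... | inj₂ ∣p∣≡-p = ℚP.≤-trans p≤0 (ℚP.0≤∣p∣ p)
  where
  p≤0 : p ≤ 0ℚ
  p≤0 = ≤-by-difference (- p) (ℚP.+-identityˡ (- p)) (subst (0ℚ ≤_) ∣p∣≡-p (ℚP.0≤∣p∣ p))

does⇒≤ : ∀ {p q} (p≤?q : Dec (p ≤ q)) → not (does p≤?q) ≡ false → p ≤ q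
does⇒≤ (yes p≤q) _ = p≤q

¬does⇒> : ∀ {p q} (p≤?q : Dec (p ≤ q)) → not (does p≤?q) ≡ true → q < p
¬does⇒> (no p≰q) _ = ℚP.≰⇒> p≰q

1-3ε-c≤[1-ε-c][1-ε]² : ∀ {ε c} → 0ℚ ≤ ε → ε ≤ 1ℚ → 0ℚ ≤ c →
  1ℚ - (ε + ε + ε + c) ≤ (1ℚ - ε - c) * (1ℚ - ε) * (1ℚ - ε)
1-3ε-c≤[1-ε-c][1-ε]² {ε} {c} 0≤ε ε≤1 0≤c =
  ≤-by-difference ((ε * ε * (1ℚ - ε) + (ε * ε + ε * ε)) + (c * ε * (1ℚ - ε) + c * ε)) (identity ε c)
    (0≤+ (0≤+ (0≤* εε 1-ε) (0≤+ εε εε)) (0≤+ (0≤* cε 1-ε) cε))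
  where
  εε : 0ℚ ≤ ε * ε
  εε = 0≤* 0≤ε 0≤ε
  cε : 0ℚ ≤ c * ε
  cε = 0≤* 0≤c 0≤ε
  1-ε : 0ℚ ≤ 1ℚ - ε
  1-ε = p≤q⇒0≤q-p ε≤1
  identity : ∀ ε c → (1ℚ - ε - c) * (1ℚ - ε) * (1ℚ - ε) - (1ℚ - (ε + ε + ε + c))
           ≡ (ε * ε * (1ℚ - ε) + (ε * ε + ε * ε)) + (c * ε * (1ℚ - ε) + c * ε)
  identity = solve-∀ ℚ-ring

toℚᵘ-toℚ : ∀ k → ℚ.toℚᵘ (toℚ k) ℚᵘ.≃ ℚᵘ.mkℚᵘ (+ k) 0
toℚᵘ-toℚ k = ℚP.toℚᵘ-fromℚᵘ (ℚᵘ.mkℚᵘ (+ k) 0)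

toℚ-+ : ∀ m n → toℚ (m ℕ.+ n) ≡ toℚ m + toℚ n
toℚ-+ m n = ℚP.toℚᵘ-injective (begin
  ℚ.toℚᵘ (toℚ (m ℕ.+ n))                       ≈⟨ toℚᵘ-toℚ (m ℕ.+ n) ⟩
  ℚᵘ.mkℚᵘ (+ (m ℕ.+ n)) 0                        ≈⟨ ℚᵘ.*≡* eq ⟩
  ℚᵘ.mkℚᵘ (+ m) 0 ℚᵘ.+ ℚᵘ.mkℚᵘ (+ n) 0           ≈⟨ ℚᵘP.+-cong (toℚᵘ-toℚ m) (toℚᵘ-toℚ n) ⟨
  ℚ.toℚᵘ (toℚ m) ℚᵘ.+ ℚ.toℚᵘ (toℚ n)           ≈⟨ ℚP.toℚᵘ-homo-+ (toℚ m) (toℚ n) ⟨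
  ℚ.toℚᵘ (toℚ m + toℚ n)                       ∎)
  where
  open ℚᵘP.≃-Reasoning
  eq : + (m ℕ.+ n) ℤ.* + 1 ≡ (+ m ℤ.* + 1 ℤ.+ + n ℤ.* + 1) ℤ.* + 1
  eq rewrite ℤP.*-identityʳ (+ (m ℕ.+ n)) | ℤP.*-identityʳ (+ m) | ℤP.*-identityʳ (+ n)
           | ℤP.*-identityʳ (+ m ℤ.+ + n) = ℤP.pos-+ m n

toℚ-* : ∀ m n → toℚ (m ℕ.* n) ≡ toℚ m * toℚ n
toℚ-* m n = ℚP.toℚᵘ-injective (begin
  ℚ.toℚᵘ (toℚ (m ℕ.* n))                       ≈⟨ toℚᵘ-toℚ (m ℕ.* n) ⟩
  ℚᵘ.mkℚᵘ (+ (m ℕ.* n)) 0                        ≈⟨ ℚᵘ.*≡* eq ⟩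
  ℚᵘ.mkℚᵘ (+ m) 0 ℚᵘ.* ℚᵘ.mkℚᵘ (+ n) 0           ≈⟨ ℚᵘP.*-cong (toℚᵘ-toℚ m) (toℚᵘ-toℚ n) ⟨
  ℚ.toℚᵘ (toℚ m) ℚᵘ.* ℚ.toℚᵘ (toℚ n)           ≈⟨ ℚP.toℚᵘ-homo-* (toℚ m) (toℚ n) ⟨
  ℚ.toℚᵘ (toℚ m * toℚ n)                       ∎)
  where
  open ℚᵘP.≃-Reasoning
  eq : + (m ℕ.* n) ℤ.* + 1 ≡ (+ m ℤ.* + n) ℤ.* + 1
  eq rewrite ℤP.*-identityʳ (+ (m ℕ.* n)) | ℤP.*-identityʳ (+ m ℤ.* + n) = ℤP.pos-* m n

toℚ-mono-≤ : ∀ {m n} → m ℕ.≤ n → toℚ m ≤ toℚ n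
toℚ-mono-≤ {m} {n} m≤n = ℚP.toℚᵘ-cancel-≤ (begin
  ℚ.toℚᵘ (toℚ m)      ≃⟨ toℚᵘ-toℚ m ⟩
  ℚᵘ.mkℚᵘ (+ m) 0      ≤⟨ ℚᵘ.*≤* (ℤP.*-monoʳ-≤-nonNeg (+ 1) (ℤ.+≤+ m≤n)) ⟩
  ℚᵘ.mkℚᵘ (+ n) 0      ≃⟨ toℚᵘ-toℚ n ⟨
  ℚ.toℚᵘ (toℚ n)      ∎)
  where open ℚᵘP.≤-Reasoning

0≤toℚ : ∀ k → 0ℚ ≤ toℚ k
0≤toℚ k = toℚ-mono-≤ {0} {k} z≤n

0<toℚ : ∀ {k} → 0 ℕ.< k → 0ℚ < toℚ k
0<toℚ {suc k} _ = ℚP.positive⁻¹ (toℚ (suc k)) {{ℚP.normalize-pos (suc k) 1}}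

-- Finite sums and subsets

sumFin-cong : ∀ {n} {f g : Fin n → ℕ} → (∀ i → f i ≡ g i) → sumFin f ≡ sumFin g
sumFin-cong {zero}  f≗g = refl
sumFin-cong {suc n} f≗g = cong₂ ℕ._+_ (f≗g F.zero) (sumFin-cong (f≗g ∘ F.suc))

sumFin-mono-≤ : ∀ {n} {f g : Fin n → ℕ} → (∀ i → f i ℕ.≤ g i) → sumFin f ℕ.≤ sumFin g
sumFin-mono-≤ {zero}  f≤g = z≤n
sumFin-mono-≤ {suc n} f≤g = ℕP.+-mono-≤ (f≤g F.zero) (sumFin-mono-≤ (f≤g ∘ F.suc))

sumFin-zero : ∀ n → sumFin {n} (λ _ → 0) ≡ 0
sumFin-zero zero    = refl
sumFin-zero (suc n) = sumFin-zero n

sumFin-distrib-+ : ∀ {n} (f g : Fin n → ℕ) → sumFin (λ i → f i ℕ.+ g i) ≡ sumFin f ℕ.+ sumFin g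
sumFin-distrib-+ {zero}  f g = refl
sumFin-distrib-+ {suc n} f g
  rewrite sumFin-distrib-+ (f ∘ F.suc) (g ∘ F.suc) = interchange (f F.zero) (g F.zero) _ _
  where
  interchange : ∀ a b c d → (a ℕ.+ b) ℕ.+ (c ℕ.+ d) ≡ (a ℕ.+ c) ℕ.+ (b ℕ.+ d)
  interchange = ℕSolver.solve-∀

sumFin-distribˡ-* : ∀ {n} k (f : Fin n → ℕ) → sumFin (λ i → k ℕ.* f i) ≡ k ℕ.* sumFin f
sumFin-distribˡ-* {zero}  k f = sym (ℕP.*-zeroʳ k)
sumFin-distribˡ-* {suc n} k f =
  trans (cong (k ℕ.* f F.zero ℕ.+_) (sumFin-distribˡ-* k (f ∘ F.suc))) (sym (ℕP.*-distribˡ-+ k _ _))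

sumFin-swap : ∀ {m n} (f : Fin m → Fin n → ℕ) →
  sumFin (λ i → sumFin (f i)) ≡ sumFin (λ j → sumFin (λ i → f i j))
sumFin-swap {zero}  {n} f = sym (sumFin-zero n)
sumFin-swap {suc m} {n} f = trans (cong (sumFin (f F.zero) ℕ.+_) (sumFin-swap (f ∘ F.suc)))
  (sym (sumFin-distrib-+ (f F.zero) (λ j → sumFin (λ i → f (F.suc i) j))))

sumFin-scaled-≤ : ∀ {n} (r s : ℚ) (f g : Fin n → ℕ) →
  (∀ i → r * toℚ (f i) ≤ s * toℚ (g i)) → r * toℚ (sumFin f) ≤ s * toℚ (sumFin g)
sumFin-scaled-≤ {zero}  r s f g rf≤sg = ℚP.≤-reflexive (trans (ℚP.*-zeroʳ r) (sym (ℚP.*-zeroʳ s)))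
sumFin-scaled-≤ {suc n} r s f g rf≤sg = begin
  r * toℚ (f F.zero ℕ.+ sumFin (f ∘ F.suc))         ≡⟨ cong (r *_) (toℚ-+ (f F.zero) _) ⟩
  r * (toℚ (f F.zero) + toℚ (sumFin (f ∘ F.suc)))   ≡⟨ ℚP.*-distribˡ-+ r _ _ ⟩
  r * toℚ (f F.zero) + r * toℚ (sumFin (f ∘ F.suc))
    ≤⟨ ℚP.+-mono-≤ (rf≤sg F.zero) (sumFin-scaled-≤ r s (f ∘ F.suc) (g ∘ F.suc) (rf≤sg ∘ F.suc)) ⟩
  s * toℚ (g F.zero) + s * toℚ (sumFin (g ∘ F.suc))  ≡⟨ ℚP.*-distribˡ-+ s _ _ ⟨
  s * (toℚ (g F.zero) + toℚ (sumFin (g ∘ F.suc)))    ≡⟨ cong (s *_) (toℚ-+ (g F.zero) _) ⟨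
  s * toℚ (g F.zero ℕ.+ sumFin (g ∘ F.suc))          ∎
  where open ℚP.≤-Reasoning

∣p∣≡sum-ind : ∀ {n} (p : Subset n) → ∣ p ∣ ≡ sumFin (λ i → ind (lookup p i))
∣p∣≡sum-ind []          = refl
∣p∣≡sum-ind (true ∷ p)  = cong suc (∣p∣≡sum-ind p)
∣p∣≡sum-ind (false ∷ p) = ∣p∣≡sum-ind p

∈⇒lookup≡true : ∀ {n} {x : Fin n} {p : Subset n} → x ∈ p → lookup p x ≡ true
∈⇒lookup≡true = VecP.[]=⇒lookup

lookup≡true⇒∈ : ∀ {n} {x : Fin n} {p : Subset n} → lookup p x ≡ true → x ∈ p
lookup≡true⇒∈ {x = x} {p} = VecP.lookup⇒[]= x p

∉⇒lookup≡false : ∀ {n} {x : Fin n} {p : Subset n} → x ∉ p → lookup p x ≡ false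
∉⇒lookup≡false {x = x} {p} x∉p with lookup p x in eq
... | true  = ⊥-elim (x∉p (lookup≡true⇒∈ eq))
... | false = refl

lookup-∩ : ∀ {n} (p q : Subset n) i → lookup (p ∩ q) i ≡ (lookup p i ∧ lookup q i)
lookup-∩ p q i = VecP.lookup-zipWith _∧_ i p q

lookup-─ : ∀ {n} (p q : Subset n) i → lookup (p ─ q) i ≡ (lookup p i ∧ not (lookup q i))
lookup-─ (s ∷ p) (inside  ∷ q) F.zero    = sym (BoolP.∧-zeroʳ s)
lookup-─ (s ∷ p) (outside ∷ q) F.zero    = sym (BoolP.∧-identityʳ s)
lookup-─ (s ∷ p) (t ∷ q)       (F.suc i) = lookup-─ p q i

∣p∪q∣≤∣p∣+∣q∣ : ∀ {n} (p q : Subset n) → ∣ p ∪ q ∣ ℕ.≤ ∣ p ∣ ℕ.+ ∣ q ∣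
∣p∪q∣≤∣p∣+∣q∣ []            []            = z≤n
∣p∪q∣≤∣p∣+∣q∣ (inside  ∷ p) (t       ∷ q) = s≤s (ℕP.≤-trans (∣p∪q∣≤∣p∣+∣q∣ p q) (ℕP.+-monoʳ-≤ ∣ p ∣ (SubsetP.∣p∣≤∣x∷p∣ t q)))
∣p∪q∣≤∣p∣+∣q∣ (outside ∷ p) (inside  ∷ q) = ℕP.≤-trans (s≤s (∣p∪q∣≤∣p∣+∣q∣ p q)) (ℕP.≤-reflexive (sym (ℕP.+-suc ∣ p ∣ ∣ q ∣)))
∣p∪q∣≤∣p∣+∣q∣ (outside ∷ p) (outside ∷ q) = ∣p∪q∣≤∣p∣+∣q∣ p q

∣p─q∣+∣q∣≡∣p∣ : ∀ {n} (p q : Subset n) → q ⊆ p → ∣ p ─ q ∣ ℕ.+ ∣ q ∣ ≡ ∣ p ∣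
∣p─q∣+∣q∣≡∣p∣ []            []            q⊆p = refl
∣p─q∣+∣q∣≡∣p∣ (inside  ∷ p) (outside ∷ q) q⊆p = cong suc (∣p─q∣+∣q∣≡∣p∣ p q (SubsetP.drop-∷-⊆ q⊆p))
∣p─q∣+∣q∣≡∣p∣ (outside ∷ p) (outside ∷ q) q⊆p = ∣p─q∣+∣q∣≡∣p∣ p q (SubsetP.drop-∷-⊆ q⊆p)
∣p─q∣+∣q∣≡∣p∣ (inside  ∷ p) (inside  ∷ q) q⊆p =
  trans (ℕP.+-suc ∣ p ─ q ∣ ∣ q ∣) (cong suc (∣p─q∣+∣q∣≡∣p∣ p q (SubsetP.drop-∷-⊆ q⊆p)))
∣p─q∣+∣q∣≡∣p∣ (outside ∷ p) (inside  ∷ q) q⊆p with q⊆p Vec.here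
... | ()

∧≡true⁻ : ∀ a {b} → (a ∧ b) ≡ true → a ≡ true × b ≡ true
∧≡true⁻ true b≡true = refl , b≡true

∧≡true⁺ : ∀ {a b} → a ≡ true → b ≡ true → (a ∧ b) ≡ true
∧≡true⁺ refl refl = refl

x∈p─q⁻ : ∀ {n} {x : Fin n} (p q : Subset n) → x ∈ p ─ q → x ∈ p × x ∉ q
x∈p─q⁻ {x = x} p q x∈p─q = lookup≡true⇒∈ (proj₁ both) , λ x∈q → false≢true
  (trans (cong not (sym (∈⇒lookup≡true x∈q))) (proj₂ both))
  where
  both : lookup p x ≡ true × not (lookup q x) ≡ true
  both = ∧≡true⁻ (lookup p x) (trans (sym (lookup-─ p q x)) (∈⇒lookup≡true x∈p─q))
  false≢true : false ≡ true → ⊥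
  false≢true ()

ind-*-≤ : ∀ {a b c d} → (a ≡ true → b ≡ true → c ≡ true × d ≡ true) → ind a ℕ.* ind b ℕ.≤ ind c ℕ.* ind d
ind-*-≤ {false} ab⇒cd = z≤n
ind-*-≤ {true} {false} ab⇒cd = z≤n
ind-*-≤ {true} {true} ab⇒cd with ab⇒cd refl refl
... | refl , refl = ℕP.≤-refl

sum-over-subset≤ : ∀ {n} (A : Subset n) (f : Fin n → ℕ) {s} → (∀ x → x ∈ A → toℚ (f x) ≤ s) →
  toℚ (sumFin (λ x → ind (lookup A x) ℕ.* f x)) ≤ s * toℚ ∣ A ∣
sum-over-subset≤ A f {s} f≤s = begin
  toℚ (sumFin (λ x → ind (lookup A x) ℕ.* f x))        ≡⟨ ℚP.*-identityˡ _ ⟨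
  1ℚ * toℚ (sumFin (λ x → ind (lookup A x) ℕ.* f x))   ≤⟨ sumFin-scaled-≤ 1ℚ s _ _ pointwise ⟩
  s * toℚ (sumFin (λ x → ind (lookup A x)))            ≡⟨ cong (λ m → s * toℚ m) (∣p∣≡sum-ind A) ⟨
  s * toℚ ∣ A ∣                                        ∎
  where
  open ℚP.≤-Reasoning
  pointwise : ∀ x → 1ℚ * toℚ (ind (lookup A x) ℕ.* f x) ≤ s * toℚ (ind (lookup A x))
  pointwise x with lookup A x in x∈A
  ... | false = ℚP.≤-reflexive (trans (ℚP.*-zeroʳ 1ℚ) (sym (ℚP.*-zeroʳ s)))
  ... | true  = begin
    1ℚ * toℚ (1 ℕ.* f x)  ≡⟨ trans (ℚP.*-identityˡ _) (cong toℚ (ℕP.*-identityˡ (f x))) ⟩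
    toℚ (f x)             ≤⟨ f≤s x (lookup≡true⇒∈ x∈A) ⟩
    s                     ≡⟨ ℚP.*-identityʳ s ⟨
    s * 1ℚ                ∎

∩⊆─∪∩ : ∀ {n} (p q r : Subset n) → p ∩ r ⊆ (p ─ q) ∪ (q ∩ r)
∩⊆─∪∩ p q r {z} z∈p∩r with SubsetP.x∈p∩q⁻ p r z∈p∩r | z SubsetP.∈? q
... | z∈p , z∈r | yes z∈q = SubsetP.x∈p∪q⁺ (inj₂ (SubsetP.x∈p∩q⁺ (z∈q , z∈r)))
... | z∈p , z∈r | no  z∉q = SubsetP.x∈p∪q⁺ (inj₁ (SubsetP.x∈p∧x∉q⇒x∈p─q z∈p z∉q))

sparse-on-large-subset⇒sparse : ∀ {n} {p q r : Subset n} {ε} → 0ℚ ≤ ε → q ⊆ p →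
  (1ℚ - ε) * toℚ ∣ p ∣ ≤ toℚ ∣ q ∣ → toℚ ∣ q ∩ r ∣ ≤ ε * toℚ ∣ q ∣ →
  toℚ ∣ p ∩ r ∣ ≤ (ε + ε) * toℚ ∣ p ∣
sparse-on-large-subset⇒sparse {p = p} {q} {r} {ε} 0≤ε q⊆p large-q sparse-q = begin
  toℚ ∣ p ∩ r ∣                    ≤⟨ toℚ-mono-≤ (SubsetP.p⊆q⇒∣p∣≤∣q∣ (∩⊆─∪∩ p q r)) ⟩
  toℚ ∣ (p ─ q) ∪ (q ∩ r) ∣        ≤⟨ toℚ-mono-≤ (∣p∪q∣≤∣p∣+∣q∣ (p ─ q) (q ∩ r)) ⟩
  toℚ (∣ p ─ q ∣ ℕ.+ ∣ q ∩ r ∣)    ≡⟨ toℚ-+ (∣ p ─ q ∣) (∣ q ∩ r ∣) ⟩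
  #p─q + #q∩r                      ≤⟨ ℚP.+-mono-≤ small-p─q (ℚP.≤-trans sparse-q (*-monoˡ-≤ 0≤ε q≤p)) ⟩
  ε * #p + ε * #p                  ≡⟨ ℚP.*-distribʳ-+ #p ε ε ⟨
  (ε + ε) * #p                     ∎
  where
  open ℚP.≤-Reasoning
  #p #q #p─q #q∩r : ℚ
  #p = toℚ ∣ p ∣
  #q∩r = toℚ ∣ q ∩ r ∣
  #q = toℚ ∣ q ∣
  #p─q = toℚ ∣ p ─ q ∣
  p≡p─q+q : #p ≡ #p─q + #q
  p≡p─q+q = trans (cong toℚ (sym (∣p─q∣+∣q∣≡∣p∣ p q q⊆p))) (toℚ-+ (∣ p ─ q ∣) (∣ q ∣))
  q≤p : #q ≤ #p
  q≤p = toℚ-mono-≤ (SubsetP.p⊆q⇒∣p∣≤∣q∣ q⊆p)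
  small-p─q : #p─q ≤ ε * #p
  small-p─q = ≤-by-difference (#q - (1ℚ - ε) * #p)
    (trans (cong (λ a → ε * a - #p─q) p≡p─q+q)
      (trans (identity ε #p─q #q) (cong (λ a → #q - (1ℚ - ε) * a) (sym p≡p─q+q))))
    (p≤q⇒0≤q-p large-q)
    where
    identity : ∀ ε s t → ε * (s + t) - s ≡ t - (1ℚ - ε) * (s + t)
    identity = solve-∀ ℚ-ring

exceeding : ∀ {n} → ℚ → (Fin n → ℕ) → Subset n
exceeding θ f = tabulate (λ v → not (does (toℚ (f v) ℚP.≤? θ)))

∉exceeding⇒≤ : ∀ {n θ} {f : Fin n → ℕ} {v} → v ∉ exceeding θ f → toℚ (f v) ≤ θ
∉exceeding⇒≤ {θ = θ} {f} {v} v∉ =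
  does⇒≤ (toℚ (f v) ℚP.≤? θ) (trans (sym (VecP.lookup∘tabulate _ v)) (∉⇒lookup≡false v∉))

markov : ∀ {n} (A : Subset n) (f : Fin n → ℕ) θ →
  θ * toℚ ∣ A ∩ exceeding θ f ∣ ≤ toℚ (sumFin (λ v → ind (lookup A v) ℕ.* f v))
markov {n} A f θ = begin
  θ * toℚ ∣ A ∩ E ∣                                  ≡⟨ cong (λ m → θ * toℚ m) (∣p∣≡sum-ind (A ∩ E)) ⟩
  θ * toℚ (sumFin (λ v → ind (lookup (A ∩ E) v)))   ≤⟨ sumFin-scaled-≤ θ 1ℚ _ _ pointwise ⟩
  1ℚ * toℚ (sumFin (λ v → ind (lookup A v) ℕ.* f v)) ≡⟨ ℚP.*-identityˡ _ ⟩
  toℚ (sumFin (λ v → ind (lookup A v) ℕ.* f v))      ∎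
  where
  open ℚP.≤-Reasoning
  E : Subset n
  E = exceeding θ f

  ∈E⇒θ≤f : ∀ v → lookup E v ≡ true → θ ≤ toℚ (f v)
  ∈E⇒θ≤f v v∈E = ℚP.<⇒≤ (¬does⇒> (toℚ (f v) ℚP.≤? θ) (trans (sym (VecP.lookup∘tabulate _ v)) v∈E))

  by-cases : ∀ v a b → (b ≡ true → θ ≤ toℚ (f v)) → θ * toℚ (ind (a ∧ b)) ≤ 1ℚ * toℚ (ind a ℕ.* f v)
  by-cases v false b     _ = ℚP.≤-reflexive (trans (ℚP.*-zeroʳ θ) (sym (ℚP.*-zeroʳ 1ℚ)))
  by-cases v true  false _ = ℚP.≤-trans (ℚP.≤-reflexive (ℚP.*-zeroʳ θ))
    (0≤* (ℚP.nonNegative⁻¹ 1ℚ) (0≤toℚ (1 ℕ.* f v)))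
  by-cases v true  true  θ≤f = begin
    θ * 1ℚ               ≡⟨ ℚP.*-identityʳ θ ⟩
    θ                    ≤⟨ θ≤f refl ⟩
    toℚ (f v)            ≡⟨ trans (cong toℚ (sym (ℕP.*-identityˡ (f v)))) (sym (ℚP.*-identityˡ _)) ⟩
    1ℚ * toℚ (1 ℕ.* f v) ∎

  pointwise : ∀ v → θ * toℚ (ind (lookup (A ∩ E) v)) ≤ 1ℚ * toℚ (ind (lookup A v) ℕ.* f v)
  pointwise v = subst (λ b → θ * toℚ (ind b) ≤ 1ℚ * toℚ (ind (lookup A v) ℕ.* f v)) (sym (lookup-∩ A E v))
    (by-cases v (lookup A v) (lookup E v) (∈E⇒θ≤f v))

-- Edge counts, densities and regular pairs

∧-leftComm : ∀ a b c → (a ∧ (b ∧ c)) ≡ (b ∧ (a ∧ c))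
∧-leftComm true  b c = refl
∧-leftComm false b c = sym (BoolP.∧-zeroʳ b)

ind-∧-≤-* : ∀ a b c → ind (a ∧ (b ∧ c)) ℕ.≤ ind a ℕ.* ind b
ind-∧-≤-* true  true  true  = ℕP.≤-refl
ind-∧-≤-* true  true  false = z≤n
ind-∧-≤-* true  false c     = z≤n
ind-∧-≤-* false b     c     = z≤n

toℚ≡divℚ*toℚ : ∀ a m → a ℕ.≤ m → toℚ a ≡ divℚ a m * toℚ m
toℚ≡divℚ*toℚ _ zero    z≤n = refl
toℚ≡divℚ*toℚ a (suc m) _   = sym (ℚP.toℚᵘ-injective (begin
  ℚ.toℚᵘ (+ a / suc m * toℚ (suc m))                ≈⟨ ℚP.toℚᵘ-homo-* (+ a / suc m) (toℚ (suc m)) ⟩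
  ℚ.toℚᵘ (+ a / suc m) ℚᵘ.* ℚ.toℚᵘ (toℚ (suc m))    ≈⟨ ℚᵘP.*-cong (ℚP.toℚᵘ-fromℚᵘ (ℚᵘ.mkℚᵘ (+ a) m)) (toℚᵘ-toℚ (suc m)) ⟩
  ℚᵘ.mkℚᵘ (+ a) m ℚᵘ.* ℚᵘ.mkℚᵘ (+ suc m) 0           ≈⟨ ℚᵘ.*≡* eq ⟩
  ℚᵘ.mkℚᵘ (+ a) 0                                    ≈⟨ toℚᵘ-toℚ a ⟨
  ℚ.toℚᵘ (toℚ a)                                    ∎))
  where
  open ℚᵘP.≃-Reasoning
  eq : (+ a ℤ.* + suc m) ℤ.* + 1 ≡ + a ℤ.* (+ (suc m) ℤ.* + 1)
  eq rewrite ℤP.*-identityʳ (+ a ℤ.* + suc m) | ℕP.*-identityʳ m = refl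

0≤divℚ : ∀ a m → 0ℚ ≤ divℚ a m
0≤divℚ a zero    = ℚP.≤-refl
0≤divℚ a (suc m) = ℚP.nonNegative⁻¹ (+ a / suc m) {{ℚP.normalize-nonNeg a (suc m)}}

0<divℚ⇒0<m : ∀ a m → 0ℚ < divℚ a m → 0 ℕ.< m
0<divℚ⇒0<m a zero    0<0 = ⊥-elim (ℚP.<-irrefl refl 0<0)
0<divℚ⇒0<m a (suc m) _   = s≤s z≤n

0<m*n⇒0<m : ∀ m n → 0 ℕ.< m ℕ.* n → 0 ℕ.< m
0<m*n⇒0<m (suc m) n _ = s≤s z≤n

module _ {n} (G : Graph n) where

  lookup-N : ∀ v i → lookup (N G v) i ≡ adj G v i
  lookup-N v = VecP.lookup∘tabulate (adj G v)

  e≤∣X∣*∣Y∣ : ∀ X Y → e G X Y ℕ.≤ ∣ X ∣ ℕ.* ∣ Y ∣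
  e≤∣X∣*∣Y∣ X Y = begin
    e G X Y
      ≤⟨ sumFin-mono-≤ (λ x → sumFin-mono-≤ (λ y → ind-∧-≤-* (lookup X x) (lookup Y y) (adj G x y))) ⟩
    sumFin (λ x → sumFin (λ y → ind (lookup X x) ℕ.* ind (lookup Y y)))
      ≡⟨ sumFin-cong (λ x → sumFin-distribˡ-* (ind (lookup X x)) (λ y → ind (lookup Y y))) ⟩
    sumFin (λ x → ind (lookup X x) ℕ.* sumFin (λ y → ind (lookup Y y)))
      ≡⟨ sumFin-cong (λ x → ℕP.*-comm (ind (lookup X x)) _) ⟩
    sumFin (λ x → sumFin (λ y → ind (lookup Y y)) ℕ.* ind (lookup X x))
      ≡⟨ sumFin-distribˡ-* (sumFin (λ y → ind (lookup Y y))) (λ x → ind (lookup X x)) ⟩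
    sumFin (λ y → ind (lookup Y y)) ℕ.* sumFin (λ x → ind (lookup X x))
      ≡⟨ cong₂ ℕ._*_ (∣p∣≡sum-ind Y) (∣p∣≡sum-ind X) ⟨
    ∣ Y ∣ ℕ.* ∣ X ∣
      ≡⟨ ℕP.*-comm ∣ Y ∣ ∣ X ∣ ⟩
    ∣ X ∣ ℕ.* ∣ Y ∣ ∎
    where open ℕP.≤-Reasoning

  toℚ-e : ∀ X Y → toℚ (e G X Y) ≡ d G X Y * (toℚ ∣ X ∣ * toℚ ∣ Y ∣)
  toℚ-e X Y = trans (toℚ≡divℚ*toℚ (e G X Y) (∣ X ∣ ℕ.* ∣ Y ∣) (e≤∣X∣*∣Y∣ X Y))
                    (cong (d G X Y *_) (toℚ-* ∣ X ∣ ∣ Y ∣))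

  e-sym : ∀ X Y → e G X Y ≡ e G Y X
  e-sym X Y = trans (sumFin-swap (λ x y → ind (lookup X x ∧ (lookup Y y ∧ adj G x y))))
    (sumFin-cong λ y → sumFin-cong λ x →
      cong ind (trans (∧-leftComm (lookup X x) (lookup Y y) (adj G x y))
                      (cong (λ b → lookup Y y ∧ (lookup X x ∧ b)) (adj-sym G x y))))

  d-sym : ∀ X Y → d G X Y ≡ d G Y X
  d-sym X Y = cong₂ divℚ (e-sym X Y) (ℕP.*-comm ∣ X ∣ ∣ Y ∣)

  0≤d : ∀ X Y → 0ℚ ≤ d G X Y
  0≤d X Y = 0≤divℚ (e G X Y) (∣ X ∣ ℕ.* ∣ Y ∣)

  0<d⇒0<∣X∣ : ∀ {X Y} → 0ℚ < d G X Y → 0ℚ < toℚ ∣ X ∣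
  0<d⇒0<∣X∣ {X} {Y} 0<d = 0<toℚ (0<m*n⇒0<m ∣ X ∣ ∣ Y ∣ (0<divℚ⇒0<m (e G X Y) _ 0<d))

  0<d⇒0<∣Y∣ : ∀ {X Y} → 0ℚ < d G X Y → 0ℚ < toℚ ∣ Y ∣
  0<d⇒0<∣Y∣ {X} {Y} 0<d = 0<d⇒0<∣X∣ {Y} {X} (subst (0ℚ <_) (d-sym X Y) 0<d)

  Regular⇒d-lower : ∀ {ε p A B A' B'} → Regular G ε p A B → A' ⊆ A → B' ⊆ B →
    ε * toℚ ∣ A ∣ ≤ toℚ ∣ A' ∣ → ε * toℚ ∣ B ∣ ≤ toℚ ∣ B' ∣ → d G A B - ε * p ≤ d G A' B'
  Regular⇒d-lower {ε} {p} {A} {B} {A'} {B'} reg A'⊆A B'⊆B large-A' large-B' =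
    ≤-by-difference (ε * p - (d G A B - d G A' B')) (rearrange (d G A' B') (d G A B) (ε * p))
      (p≤q⇒0≤q-p (ℚP.≤-trans (p≤∣p∣ _) (reg A' B' A'⊆A B'⊆B large-A' large-B')))
    where
    rearrange : ∀ x y t → x - (y - t) ≡ t - (y - x)
    rearrange = solve-∀ ℚ-ring

  ∣N∩X∣≡sum : ∀ y X → ∣ N G y ∩ X ∣ ≡ sumFin (λ x → ind (lookup X x ∧ adj G x y))
  ∣N∩X∣≡sum y X = trans (∣p∣≡sum-ind (N G y ∩ X)) (sumFin-cong λ x → cong ind (begin
    lookup (N G y ∩ X) x      ≡⟨ lookup-∩ (N G y) X x ⟩
    lookup (N G y) x ∧ lookup X x ≡⟨ cong (_∧ lookup X x) (trans (lookup-N y x) (adj-sym G y x)) ⟩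
    adj G x y ∧ lookup X x    ≡⟨ BoolP.∧-comm (adj G x y) (lookup X x) ⟩
    lookup X x ∧ adj G x y    ∎))
    where open ≡-Reasoning

  toℚ-e≤*∣Y∣ : ∀ {X Y k} → (∀ y → y ∈ Y → toℚ ∣ N G y ∩ X ∣ ≤ k) → toℚ (e G X Y) ≤ k * toℚ ∣ Y ∣
  toℚ-e≤*∣Y∣ {X} {Y} {k} deg≤k = begin
    toℚ (e G X Y)                    ≡⟨ cong toℚ (sumFin-swap edge) ⟩
    toℚ (sumFin (λ y → sumFin (λ x → edge x y)))   ≡⟨ ℚP.*-identityˡ _ ⟨
    1ℚ * toℚ (sumFin (λ y → sumFin (λ x → edge x y)))
      ≤⟨ sumFin-scaled-≤ 1ℚ k _ (λ y → ind (lookup Y y)) column≤ ⟩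
    k * toℚ (sumFin (λ y → ind (lookup Y y)))     ≡⟨ cong (λ m → k * toℚ m) (∣p∣≡sum-ind Y) ⟨
    k * toℚ ∣ Y ∣                    ∎
    where
    open ℚP.≤-Reasoning
    edge : Fin n → Fin n → ℕ
    edge x y = ind (lookup X x ∧ (lookup Y y ∧ adj G x y))
    column≤ : ∀ y → 1ℚ * toℚ (sumFin (λ x → edge x y)) ≤ k * toℚ (ind (lookup Y y))
    column≤ y with lookup Y y in y∈Y
    ... | true  = ℚP.≤-trans (ℚP.≤-reflexive (trans (ℚP.*-identityˡ _) (cong toℚ (sym (∣N∩X∣≡sum y X)))))
                    (ℚP.≤-trans (deg≤k y (lookup≡true⇒∈ y∈Y)) (ℚP.≤-reflexive (sym (ℚP.*-identityʳ k))))
    ... | false = ℚP.≤-reflexive (begin-equality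
      1ℚ * toℚ (sumFin (λ x → ind (lookup X x ∧ false)))
        ≡⟨ cong (λ m → 1ℚ * toℚ m) (trans (sumFin-cong (λ x → cong ind (BoolP.∧-zeroʳ (lookup X x)))) (sumFin-zero n)) ⟩
      1ℚ * 0ℚ ≡⟨ ℚP.*-zeroʳ 1ℚ ⟩
      0ℚ      ≡⟨ ℚP.*-zeroʳ k ⟨
      k * 0ℚ  ∎)

  e-split : ∀ {A S} B → S ⊆ A → e G A B ≡ e G S B ℕ.+ e G (A ─ S) B
  e-split {A} {S} B S⊆A = begin
    e G A B
      ≡⟨ sumFin-cong (λ x → sumFin-cong (λ y → split-ind (lookup A x) (lookup S x) (lookup B y ∧ adj G x y)
           (λ x∈S → ∈⇒lookup≡true (S⊆A (lookup≡true⇒∈ x∈S))))) ⟩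
    sumFin (λ x → sumFin (λ y → inS x y ℕ.+ inA─S x y))
      ≡⟨ sumFin-cong (λ x → sumFin-distrib-+ (inS x) (inA─S x)) ⟩
    sumFin (λ x → sumFin (inS x) ℕ.+ sumFin (inA─S x))
      ≡⟨ sumFin-distrib-+ (λ x → sumFin (inS x)) (λ x → sumFin (inA─S x)) ⟩
    e G S B ℕ.+ sumFin (λ x → sumFin (inA─S x))
      ≡⟨ cong (e G S B ℕ.+_) (sumFin-cong λ x → sumFin-cong λ y →
           cong (λ b → ind (b ∧ (lookup B y ∧ adj G x y))) (sym (lookup-─ A S x))) ⟩
    e G S B ℕ.+ e G (A ─ S) B ∎
    where
    open ≡-Reasoning
    inS inA─S : Fin n → Fin n → ℕ
    inS x y = ind (lookup S x ∧ (lookup B y ∧ adj G x y))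
    inA─S x y = ind ((lookup A x ∧ not (lookup S x)) ∧ (lookup B y ∧ adj G x y))
    split-ind : ∀ a s r → (s ≡ true → a ≡ true) → ind (a ∧ r) ≡ ind (s ∧ r) ℕ.+ ind ((a ∧ not s) ∧ r)
    split-ind true  false r s⇒a = refl
    split-ind false false r s⇒a = refl
    split-ind true  true  r s⇒a = sym (ℕP.+-identityʳ (ind r))
    split-ind false true  r s⇒a with s⇒a refl
    ... | ()

  -- Regularity pins down the density of A ─ S, hence also the number of edges left for S.
  Regular⇒e-small-part : ∀ {ε p A B S} → 0ℚ ≤ ε → 0ℚ ≤ p → ε + ε ≤ 1ℚ → Regular G ε p A B →
    S ⊆ A → toℚ ∣ S ∣ ≤ ε * toℚ ∣ A ∣ →
    toℚ (e G S B) ≤ ε * (d G A B + p) * (toℚ ∣ A ∣ * toℚ ∣ B ∣)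
  Regular⇒e-small-part {ε} {p} {A} {B} {S} 0≤ε 0≤p 2ε≤1 reg S⊆A small-S =
    subst (λ a → toℚ (e G S B) ≤ ε * (D + p) * (a * b)) (sym a≡t+s)
      (≤-by-difference _ difference
        (0≤+ (0≤+ (p≤q⇒0≤q-p X-lower) (0≤* (0≤* (0≤d A B) (0≤toℚ ∣ B ∣)) (p≤q⇒0≤q-p small-S')))
             (0≤* (0≤* (0≤* 0≤ε 0≤p) (0≤toℚ ∣ S ∣)) (0≤toℚ ∣ B ∣))))
    where
    T : Subset n
    T = A ─ S
    D b s t X : ℚ
    D = d G A B
    b = toℚ ∣ B ∣
    s = toℚ ∣ S ∣
    t = toℚ ∣ T ∣
    X = toℚ (e G T B)

    a≡t+s : toℚ ∣ A ∣ ≡ t + s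
    a≡t+s = trans (cong toℚ (sym (∣p─q∣+∣q∣≡∣p∣ A S S⊆A))) (toℚ-+ ∣ T ∣ ∣ S ∣)

    small-S' : s ≤ ε * (t + s)
    small-S' = subst (λ a → s ≤ ε * a) a≡t+s small-S

    large-T : ε * toℚ ∣ A ∣ ≤ t
    large-T = subst (λ a → ε * a ≤ t) (sym a≡t+s)
      (≤-by-difference ((ε * (t + s) - s) + (1ℚ - (ε + ε)) * (t + s)) (identity ε t s)
        (0≤+ (p≤q⇒0≤q-p small-S') (0≤* (p≤q⇒0≤q-p 2ε≤1) (0≤+ (0≤toℚ ∣ T ∣) (0≤toℚ ∣ S ∣)))))
      where
      identity : ∀ ε t s → t - ε * (t + s) ≡ (ε * (t + s) - s) + (1ℚ - (ε + ε)) * (t + s)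
      identity = solve-∀ ℚ-ring

    εb≤b : ε * b ≤ b
    εb≤b = ≤-by-difference (((1ℚ - (ε + ε)) + ε) * b) (identity ε b)
      (0≤* (0≤+ (p≤q⇒0≤q-p 2ε≤1) 0≤ε) (0≤toℚ ∣ B ∣))
      where
      identity : ∀ ε b → b - ε * b ≡ ((1ℚ - (ε + ε)) + ε) * b
      identity = solve-∀ ℚ-ring

    X-lower : (D - ε * p) * (t * b) ≤ X
    X-lower = ℚP.≤-trans
      (*-monoʳ-≤ (0≤* (0≤toℚ ∣ T ∣) (0≤toℚ ∣ B ∣))
        (Regular⇒d-lower {ε} {p} reg (SubsetP.p─q⊆p A S) (λ y∈B → y∈B) large-T εb≤b))
      (ℚP.≤-reflexive (sym (toℚ-e T B)))

    e-S : toℚ (e G S B) ≡ D * ((t + s) * b) - X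
    e-S = begin
      toℚ (e G S B)                   ≡⟨ x≡x+y-y (toℚ (e G S B)) X ⟩
      (toℚ (e G S B) + X) - X         ≡⟨ cong (_- X) (toℚ-+ (e G S B) (e G T B)) ⟨
      toℚ (e G S B ℕ.+ e G T B) - X   ≡⟨ cong (λ m → toℚ m - X) (e-split B S⊆A) ⟨
      toℚ (e G A B) - X               ≡⟨ cong (_- X) (trans (toℚ-e A B) (cong (λ a → D * (a * b)) a≡t+s)) ⟩
      D * ((t + s) * b) - X           ∎
      where
      open ≡-Reasoning
      x≡x+y-y : ∀ x y → x ≡ (x + y) - y
      x≡x+y-y = solve-∀ ℚ-ring

    difference : ε * (D + p) * ((t + s) * b) - toℚ (e G S B)
               ≡ ((X - (D - ε * p) * (t * b)) + D * b * (ε * (t + s) - s)) + ε * p * s * b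
    difference = trans (cong (λ E → ε * (D + p) * ((t + s) * b) - E) e-S) (identity ε D p t s b X)
      where
      identity : ∀ ε D p t s b X → ε * (D + p) * ((t + s) * b) - (D * ((t + s) * b) - X)
                 ≡ ((X - (D - ε * p) * (t * b)) + D * b * (ε * (t + s) - s)) + ε * p * s * b
      identity = solve-∀ ℚ-ring

module _ {n} (G : Graph n) {ε ε' p : ℚ} (ε≤ε' : ε ≤ ε') (0≤p : 0ℚ ≤ p) where

  private
    lower-mono : ∀ x → 0ℚ ≤ x → (1ℚ - ε') * x ≤ (1ℚ - ε) * x
    lower-mono x 0≤x = ≤-by-difference ((ε' - ε) * x) (identity ε ε' x) (0≤* (p≤q⇒0≤q-p ε≤ε') 0≤x)
      where
      identity : ∀ ε ε' x → (1ℚ - ε) * x - (1ℚ - ε') * x ≡ (ε' - ε) * x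
      identity = solve-∀ ℚ-ring

    upper-mono : ∀ x → 0ℚ ≤ x → (1ℚ + ε) * x ≤ (1ℚ + ε') * x
    upper-mono x 0≤x = ≤-by-difference ((ε' - ε) * x) (identity ε ε' x) (0≤* (p≤q⇒0≤q-p ε≤ε') 0≤x)
      where
      identity : ∀ ε ε' x → (1ℚ + ε') * x - (1ℚ + ε) * x ≡ (ε' - ε) * x
      identity = solve-∀ ℚ-ring

  Regular-mono : ∀ {A B} → Regular G ε p A B → Regular G ε' p A B
  Regular-mono {A} {B} reg A' B' A'⊆A B'⊆B large-A' large-B' = ℚP.≤-trans
    (reg A' B' A'⊆A B'⊆B (ℚP.≤-trans (*-monoʳ-≤ (0≤toℚ ∣ A ∣) ε≤ε') large-A')
                         (ℚP.≤-trans (*-monoʳ-≤ (0≤toℚ ∣ B ∣) ε≤ε') large-B'))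
    (*-monoʳ-≤ 0≤p ε≤ε')

  DegOK-mono : ∀ {Vᵢ Vₗ v} → DegOK G ε Vᵢ Vₗ v → DegOK G ε' Vᵢ Vₗ v
  DegOK-mono {Vᵢ} {Vₗ} (lower , upper) =
    ℚP.≤-trans (*-monoʳ-≤ (0≤toℚ ∣ Vₗ ∣) (lower-mono _ (0≤d G Vᵢ Vₗ))) lower ,
    ℚP.≤-trans upper (*-monoʳ-≤ (0≤toℚ ∣ Vₗ ∣) (upper-mono _ (0≤d G Vᵢ Vₗ)))

  TypicalVertex-mono : ∀ {Vᵢ Vⱼ Vₖ v} → TypicalVertex G ε p Vᵢ Vⱼ Vₖ v → TypicalVertex G ε' p Vᵢ Vⱼ Vₖ v
  TypicalVertex-mono {Vᵢ} {Vⱼ} {Vₖ} {v} (degⱼ , degₖ , Nⱼ' , Nₖ' , Nⱼ'⊆ , Nₖ'⊆ , large-Nⱼ' , large-Nₖ' , reg , lower , upper) =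
    DegOK-mono {Vᵢ} degⱼ , DegOK-mono {Vᵢ} degₖ , Nⱼ' , Nₖ' , Nⱼ'⊆ , Nₖ'⊆ ,
    ℚP.≤-trans (lower-mono _ (0≤toℚ ∣ N G v ∩ Vⱼ ∣)) large-Nⱼ' ,
    ℚP.≤-trans (lower-mono _ (0≤toℚ ∣ N G v ∩ Vₖ ∣)) large-Nₖ' ,
    Regular-mono reg ,
    ℚP.≤-trans (lower-mono _ (0≤d G Vⱼ Vₖ)) lower ,
    ℚP.≤-trans upper (upper-mono _ (0≤d G Vⱼ Vₖ))

-- A row of an exceptional vertex (s = true) is bounded by its full degree.
row-split : ∀ {n} (a s : Bool) (b c g : Fin n → Bool) →
  sumFin (λ y → ind (a ∧ (b y ∧ (c y ∧ g y))))
    ℕ.≤ sumFin (λ y → ind (s ∧ (b y ∧ c y))) ℕ.+ ind (a ∧ not s) ℕ.* sumFin (λ y → ind (b y ∧ (c y ∧ g y)))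
row-split {n} false s     b c g = ℕP.≤-trans (ℕP.≤-reflexive (sumFin-zero n)) z≤n
row-split {n} true  true  b c g = ℕP.≤-trans (sumFin-mono-≤ λ y → ind-∧-≤ (b y) (c y) (g y)) (ℕP.m≤m+n _ 0)
  where
  ind-∧-≤ : ∀ a b c → ind (a ∧ (b ∧ c)) ℕ.≤ ind (a ∧ b)
  ind-∧-≤ true  true  true  = ℕP.≤-refl
  ind-∧-≤ true  true  false = z≤n
  ind-∧-≤ true  false c     = z≤n
  ind-∧-≤ false b     c     = z≤n
row-split {n} true  false b c g =
  ℕP.≤-reflexive (sym (trans (cong (ℕ._+ (row ℕ.+ 0)) (sumFin-zero n)) (ℕP.+-identityʳ row)))
  where
  row : ℕ
  row = sumFin (λ y → ind (b y ∧ (c y ∧ g y)))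

-- Edges of (V₂, V₃) that are not ε'-good

module BadEdges {n} (G : Graph n) (ε' : ℚ) (V₁ V₂ V₃ : Subset n) where

  good : Fin n → Fin n → Bool
  good = goodEdge? G ε' V₁ V₂ V₃

  K : ℚ
  K = (1ℚ - ε') * d G V₁ V₂ * d G V₁ V₃ * toℚ ∣ V₁ ∣

  nonGoodPartners : Fin n → Subset n
  nonGoodPartners x = tabulate (λ y → not (good x y))

  nonGoodPartner⇒common≤K : ∀ {x y} → y ∈ nonGoodPartners x → toℚ (common G x y V₁) ≤ K
  nonGoodPartner⇒common≤K {x} {y} y∈ = ℚP.<⇒≤
    (¬does⇒> (K ℚP.≤? toℚ (common G x y V₁)) (trans (sym (VecP.lookup∘tabulate _ y)) (∈⇒lookup≡true y∈)))

  badDegree : Fin n → ℕ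
  badDegree x = ∣ (N G x ∩ V₃) ∩ nonGoodPartners x ∣

  module _ {ε p c : ℚ} (0≤ε : 0ℚ ≤ ε) (0≤c : 0ℚ ≤ c) (ε+c≤1 : ε + c ≤ 1ℚ)
           (3ε+c<ε' : ε + ε + ε + c < ε') (εp≤cd₁₃ : ε * p ≤ c * d G V₁ V₃)
           (0<d₁₂ : 0ℚ < d G V₁ V₂) (0<d₁₃ : 0ℚ < d G V₁ V₃) where

    private
      ε≤1 : ε ≤ 1ℚ
      ε≤1 = ≤-by-difference ((1ℚ - (ε + c)) + c) (identity ε c) (0≤+ (p≤q⇒0≤q-p ε+c≤1) 0≤c)
        where
        identity : ∀ ε c → 1ℚ - ε ≡ (1ℚ - (ε + c)) + c
        identity = solve-∀ ℚ-ring

      0≤1-ε : 0ℚ ≤ 1ℚ - ε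
      0≤1-ε = p≤q⇒0≤q-p ε≤1

    -- If the set L of non-good partners in C' had more than ε|C'| elements, regularity would give
    -- e(A', L) ≥ (1 - ε - c) d₁₃ |A'| |L| ≥ (1 - ε - c)(1 - ε)² d₁₂ d₁₃ |V₁| |L|, while every y ∈ L
    -- has at most (1 - ε') d₁₂ d₁₃ |V₁| neighbours in A' ⊆ N(x) ∩ V₁; this contradicts 3ε + c < ε'.
    regular-pair⇒few-nonGood : ∀ {x A' C'} → A' ⊆ N G x ∩ V₁ →
      (1ℚ - ε) * ((1ℚ - ε) * d G V₁ V₂ * toℚ ∣ V₁ ∣) ≤ toℚ ∣ A' ∣ →
      Regular G ε p A' C' → (1ℚ - ε) * d G V₁ V₃ ≤ d G A' C' →
      toℚ ∣ C' ∩ nonGoodPartners x ∣ ≤ ε * toℚ ∣ C' ∣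
    regular-pair⇒few-nonGood {x} {A'} {C'} A'⊆ large-A' reg dense = ℚP.≮⇒≥ absurd
      where
      L : Subset n
      L = C' ∩ nonGoodPartners x
      D₁₂ D₁₃ a' l u P : ℚ
      D₁₂ = d G V₁ V₂
      D₁₃ = d G V₁ V₃
      a' = toℚ ∣ A' ∣
      l = toℚ ∣ L ∣
      u = 1ℚ - ε - c
      P = D₁₂ * D₁₃ * toℚ ∣ V₁ ∣

      0≤u : 0ℚ ≤ u
      0≤u = subst (0ℚ ≤_) (identity ε c) (p≤q⇒0≤q-p ε+c≤1)
        where
        identity : ∀ ε c → 1ℚ - (ε + c) ≡ 1ℚ - ε - c
        identity = solve-∀ ℚ-ring

      common-nbrs : ∀ y → y ∈ L → toℚ ∣ N G y ∩ A' ∣ ≤ K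
      common-nbrs y y∈L = ℚP.≤-trans (toℚ-mono-≤ (SubsetP.p⊆q⇒∣p∣≤∣q∣ inclusion))
        (nonGoodPartner⇒common≤K (proj₂ (SubsetP.x∈p∩q⁻ C' _ y∈L)))
        where
        inclusion : N G y ∩ A' ⊆ N G x ∩ (N G y ∩ V₁)
        inclusion z∈ with SubsetP.x∈p∩q⁻ (N G y) A' z∈
        ... | z∈Ny , z∈A' with SubsetP.x∈p∩q⁻ (N G x) V₁ (A'⊆ z∈A')
        ...   | z∈Nx , z∈V₁ = SubsetP.x∈p∩q⁺ (z∈Nx , SubsetP.x∈p∩q⁺ (z∈Ny , z∈V₁))

      absurd : ε * toℚ ∣ C' ∣ < l → ⊥
      absurd many = ℚP.<-irrefl refl (ℚP.<-≤-trans 1-ε'<1-3ε-c (ℚP.≤-trans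
        (1-3ε-c≤[1-ε-c][1-ε]² 0≤ε ε≤1 0≤c) (*-cancelʳ-≤ 0<P u[1-ε]²P≤[1-ε']P)))
        where
        1-ε'<1-3ε-c : 1ℚ - ε' < 1ℚ - (ε + ε + ε + c)
        1-ε'<1-3ε-c = <-by-difference (ε' - (ε + ε + ε + c)) (identity ε' (ε + ε + ε + c)) (p<q⇒0<q-p 3ε+c<ε')
          where
          identity : ∀ ε' t → 1ℚ - t - (1ℚ - ε') ≡ ε' - t
          identity = solve-∀ ℚ-ring

        0<l : 0ℚ < l
        0<l = ℚP.≤-<-trans (0≤* 0≤ε (0≤toℚ ∣ C' ∣)) many

        0<P : 0ℚ < P
        0<P = 0<* (0<* 0<d₁₂ 0<d₁₃) (0<d⇒0<∣X∣ G {V₁} {V₂} 0<d₁₂)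

        uD₁₃≤d[A',L] : u * D₁₃ ≤ d G A' L
        uD₁₃≤d[A',L] = ℚP.≤-trans
          (≤-by-difference ((d G A' C' - (1ℚ - ε) * D₁₃) + (c * D₁₃ - ε * p)) (identity (d G A' C') D₁₃ ε c p)
            (0≤+ (p≤q⇒0≤q-p dense) (p≤q⇒0≤q-p εp≤cd₁₃)))
          (Regular⇒d-lower G {ε} {p} reg (λ z∈A' → z∈A') (λ y∈L → proj₁ (SubsetP.x∈p∩q⁻ C' _ y∈L))
            (≤-by-difference ((1ℚ - ε) * a') (identity' ε a') (0≤* 0≤1-ε (0≤toℚ ∣ A' ∣))) (ℚP.<⇒≤ many))
          where
          identity : ∀ d d₁₃ ε c p → d - ε * p - (1ℚ - ε - c) * d₁₃ ≡ (d - (1ℚ - ε) * d₁₃) + (c * d₁₃ - ε * p)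
          identity = solve-∀ ℚ-ring
          identity' : ∀ ε a → a - ε * a ≡ (1ℚ - ε) * a
          identity' = solve-∀ ℚ-ring

        uD₁₃a'≤K : u * D₁₃ * a' ≤ K
        uD₁₃a'≤K = *-cancelʳ-≤ 0<l (begin
          u * D₁₃ * a' * l        ≡⟨ ℚP.*-assoc (u * D₁₃) a' l ⟩
          u * D₁₃ * (a' * l)      ≤⟨ *-monoʳ-≤ (0≤* (0≤toℚ ∣ A' ∣) (0≤toℚ ∣ L ∣)) uD₁₃≤d[A',L] ⟩
          d G A' L * (a' * l)     ≡⟨ toℚ-e G A' L ⟨
          toℚ (e G A' L)          ≤⟨ toℚ-e≤*∣Y∣ G common-nbrs ⟩
          K * l                   ∎)
          where open ℚP.≤-Reasoning

        u[1-ε]²P≤[1-ε']P : u * (1ℚ - ε) * (1ℚ - ε) * P ≤ (1ℚ - ε') * P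
        u[1-ε]²P≤[1-ε']P = begin
          u * (1ℚ - ε) * (1ℚ - ε) * P
            ≡⟨ identity u ε D₁₂ D₁₃ (toℚ ∣ V₁ ∣) ⟩
          u * D₁₃ * ((1ℚ - ε) * ((1ℚ - ε) * D₁₂ * toℚ ∣ V₁ ∣))
            ≤⟨ *-monoˡ-≤ (0≤* 0≤u (ℚP.<⇒≤ 0<d₁₃)) large-A' ⟩
          u * D₁₃ * a'
            ≤⟨ uD₁₃a'≤K ⟩
          K
            ≡⟨ identity' ε' D₁₂ D₁₃ (toℚ ∣ V₁ ∣) ⟩
          (1ℚ - ε') * P ∎
          where
          open ℚP.≤-Reasoning
          identity : ∀ u ε d₁₂ d₁₃ a → u * (1ℚ - ε) * (1ℚ - ε) * (d₁₂ * d₁₃ * a)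
                   ≡ u * d₁₃ * ((1ℚ - ε) * ((1ℚ - ε) * d₁₂ * a))
          identity = solve-∀ ℚ-ring
          identity' : ∀ ε' d₁₂ d₁₃ a → (1ℚ - ε') * d₁₂ * d₁₃ * a ≡ (1ℚ - ε') * (d₁₂ * d₁₃ * a)
          identity' = solve-∀ ℚ-ring

    typical⇒badDegree≤ : ∀ {x} → TypicalVertex G ε p V₂ V₁ V₃ x →
      toℚ (badDegree x) ≤ (ε + ε) * ((1ℚ + ε) * d G V₂ V₃ * toℚ ∣ V₃ ∣)
    typical⇒badDegree≤ {x} ((deg₁ , _) , (_ , deg₃) , A' , C' , A'⊆ , C'⊆ , large-A' , large-C' , reg , dense , _) =
      ℚP.≤-trans
        (sparse-on-large-subset⇒sparse 0≤ε C'⊆ large-C' (regular-pair⇒few-nonGood A'⊆ large-A'' reg dense))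
        (*-monoˡ-≤ (0≤+ 0≤ε 0≤ε) deg₃)
      where
      large-A'' : (1ℚ - ε) * ((1ℚ - ε) * d G V₁ V₂ * toℚ ∣ V₁ ∣) ≤ toℚ ∣ A' ∣
      large-A'' = ℚP.≤-trans
        (*-monoˡ-≤ 0≤1-ε (subst (λ D → (1ℚ - ε) * D * toℚ ∣ V₁ ∣ ≤ toℚ ∣ N G x ∩ V₁ ∣) (d-sym G V₂ V₁) deg₁))
        large-A'

  Bad : ℕ
  Bad = badEdges G ε' V₁ V₂ V₃ V₂ V₃

  badDegree≡sum : ∀ x → badDegree x ≡ sumFin (λ y → ind (lookup V₃ y ∧ (adj G x y ∧ not (good x y))))
  badDegree≡sum x = trans (∣p∣≡sum-ind ((N G x ∩ V₃) ∩ nonGoodPartners x)) (sumFin-cong λ y → cong ind (begin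
    lookup ((N G x ∩ V₃) ∩ nonGoodPartners x) y
      ≡⟨ lookup-∩ (N G x ∩ V₃) _ y ⟩
    lookup (N G x ∩ V₃) y ∧ lookup (nonGoodPartners x) y
      ≡⟨ cong₂ _∧_ (trans (lookup-∩ (N G x) V₃ y) (cong (_∧ lookup V₃ y) (lookup-N G x y)))
                   (VecP.lookup∘tabulate _ y) ⟩
    (adj G x y ∧ lookup V₃ y) ∧ not (good x y)
      ≡⟨ cong (_∧ not (good x y)) (BoolP.∧-comm (adj G x y) (lookup V₃ y)) ⟩
    (lookup V₃ y ∧ adj G x y) ∧ not (good x y)
      ≡⟨ BoolP.∧-assoc (lookup V₃ y) (adj G x y) _ ⟩
    lookup V₃ y ∧ (adj G x y ∧ not (good x y)) ∎))
    where open ≡-Reasoning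

  Bad≤ : ∀ {S} → S ⊆ V₂ → Bad ℕ.≤ e G S V₃ ℕ.+ sumFin (λ x → ind (lookup (V₂ ─ S) x) ℕ.* badDegree x)
  Bad≤ {S} S⊆V₂ = ℕP.≤-trans (sumFin-mono-≤ row≤)
    (ℕP.≤-reflexive (sumFin-distrib-+ (λ x → sumFin (λ y → ind (lookup S x ∧ (lookup V₃ y ∧ adj G x y)))) _))
    where
    row≤ : ∀ x → sumFin (λ y → ind (lookup V₂ x ∧ (lookup V₃ y ∧ (adj G x y ∧ not (good x y)))))
                 ℕ.≤ sumFin (λ y → ind (lookup S x ∧ (lookup V₃ y ∧ adj G x y)))
                     ℕ.+ ind (lookup (V₂ ─ S) x) ℕ.* badDegree x
    row≤ x = ℕP.≤-trans
      (row-split (lookup V₂ x) (lookup S x) (lookup V₃) (adj G x) (λ y → not (good x y)))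
      (ℕP.≤-reflexive (cong₂ (λ a m → sumFin (λ y → ind (lookup S x ∧ (lookup V₃ y ∧ adj G x y))) ℕ.+ ind a ℕ.* m)
        (sym (lookup-─ V₂ S x)) (sym (badDegree≡sum x))))
  badAt : Fin n → ℕ
  badAt v = badEdges G ε' V₁ V₂ V₃ (N G v ∩ V₂) (N G v ∩ V₃)

  private
    bad? : Fin n → Fin n → Bool
    bad? x y = lookup V₂ x ∧ (lookup V₃ y ∧ (adj G x y ∧ not (good x y)))

    ∈N⇒adj : ∀ {v x} → x ∈ N G v → adj G v x ≡ true
    ∈N⇒adj {v} {x} x∈Nv = trans (sym (lookup-N G v x)) (∈⇒lookup≡true x∈Nv)

    adj⇒∈N : ∀ {v x} → adj G v x ≡ true → x ∈ N G v
    adj⇒∈N {v} {x} adj≡true = lookup≡true⇒∈ (trans (lookup-N G v x) adj≡true)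

    -- A bad edge xy seen from v ∈ V₁ makes v a common neighbour of x and y.
    seen-from : ∀ v x y → lookup V₁ v ≡ true →
      (lookup (N G v ∩ V₂) x ∧ (lookup (N G v ∩ V₃) y ∧ (adj G x y ∧ not (good x y)))) ≡ true →
      bad? x y ≡ true × lookup (N G x ∩ (N G y ∩ V₁)) v ≡ true
    seen-from v x y v∈V₁ seen =
      ∧≡true⁺ (∈⇒lookup≡true {p = V₂} x∈V₂) (∧≡true⁺ (∈⇒lookup≡true {p = V₃} y∈V₃) (proj₂ (∧≡true⁻ (lookup (N G v ∩ V₃) y) rest))) ,
      ∈⇒lookup≡true (SubsetP.x∈p∩q⁺ (v∈Nx , SubsetP.x∈p∩q⁺ (v∈Ny , lookup≡true⇒∈ v∈V₁)))
      where
      rest : (lookup (N G v ∩ V₃) y ∧ (adj G x y ∧ not (good x y))) ≡ true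
      rest = proj₂ (∧≡true⁻ (lookup (N G v ∩ V₂) x) seen)
      x∈Nv∩V₂ : x ∈ N G v × x ∈ V₂
      x∈Nv∩V₂ = SubsetP.x∈p∩q⁻ (N G v) V₂ (lookup≡true⇒∈ {p = N G v ∩ V₂} (proj₁ (∧≡true⁻ (lookup (N G v ∩ V₂) x) seen)))
      y∈Nv∩V₃ : y ∈ N G v × y ∈ V₃
      y∈Nv∩V₃ = SubsetP.x∈p∩q⁻ (N G v) V₃ (lookup≡true⇒∈ {p = N G v ∩ V₃} (proj₁ (∧≡true⁻ (lookup (N G v ∩ V₃) y) rest)))
      x∈V₂ : x ∈ V₂
      x∈V₂ = proj₂ x∈Nv∩V₂
      y∈V₃ : y ∈ V₃
      y∈V₃ = proj₂ y∈Nv∩V₃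
      v∈Nx : v ∈ N G x
      v∈Nx = adj⇒∈N (trans (adj-sym G x v) (∈N⇒adj (proj₁ x∈Nv∩V₂)))
      v∈Ny : v ∈ N G y
      v∈Ny = adj⇒∈N (trans (adj-sym G y v) (∈N⇒adj (proj₁ y∈Nv∩V₃)))

  -- Double counting the triples (v, x, y) with v ∈ V₁ and xy a bad edge inside N(v).
  sum-badAt≤ : ∀ {k} → NoHeavyEdge G k V₁ V₂ V₃ →
    toℚ (sumFin (λ v → ind (lookup V₁ v) ℕ.* badAt v)) ≤ k * toℚ ∣ V₁ ∣ * toℚ Bad
  sum-badAt≤ {k} no-heavy = begin
    toℚ (sumFin (λ v → ind (lookup V₁ v) ℕ.* badAt v))
      ≡⟨ cong toℚ reindex ⟩
    toℚ (sumFin (λ x → sumFin (λ y → sumFin (λ v → F v x y))))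
      ≡⟨ ℚP.*-identityˡ _ ⟨
    1ℚ * toℚ (sumFin (λ x → sumFin (λ y → sumFin (λ v → F v x y))))
      ≤⟨ sumFin-scaled-≤ 1ℚ (k * toℚ ∣ V₁ ∣) _ _ (λ x →
           sumFin-scaled-≤ 1ℚ (k * toℚ ∣ V₁ ∣) _ _ (λ y → per-edge x y)) ⟩
    k * toℚ ∣ V₁ ∣ * toℚ Bad ∎
    where
    open ℚP.≤-Reasoning
    I F : Fin n → Fin n → Fin n → ℕ
    I v x y = ind (lookup (N G v ∩ V₂) x ∧ (lookup (N G v ∩ V₃) y ∧ (adj G x y ∧ not (good x y))))
    F v x y = ind (lookup V₁ v) ℕ.* I v x y

    reindex : sumFin (λ v → ind (lookup V₁ v) ℕ.* badAt v) ≡ sumFin (λ x → sumFin (λ y → sumFin (λ v → F v x y)))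
    reindex = trans
      (sumFin-cong λ v → trans (sym (sumFin-distribˡ-* (ind (lookup V₁ v)) (λ x → sumFin (I v x))))
                               (sumFin-cong λ x → sym (sumFin-distribˡ-* (ind (lookup V₁ v)) (I v x))))
      (trans (sumFin-swap (λ v x → sumFin (F v x))) (sumFin-cong λ x → sumFin-swap (λ v y → F v x y)))

    through-common : ∀ x y → sumFin (λ v → F v x y) ℕ.≤ ind (bad? x y) ℕ.* common G x y V₁
    through-common x y = ℕP.≤-trans (sumFin-mono-≤ λ v → ind-*-≤ (seen-from v x y))
      (ℕP.≤-reflexive (trans (sumFin-distribˡ-* (ind (bad? x y)) (λ v → ind (lookup (N G x ∩ (N G y ∩ V₁)) v)))
        (cong (ind (bad? x y) ℕ.*_) (sym (∣p∣≡sum-ind (N G x ∩ (N G y ∩ V₁)))))))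

    per-edge : ∀ x y → 1ℚ * toℚ (sumFin (λ v → F v x y)) ≤ k * toℚ ∣ V₁ ∣ * toℚ (ind (bad? x y))
    per-edge x y = ℚP.≤-trans (*-monoˡ-≤ (ℚP.nonNegative⁻¹ 1ℚ) (toℚ-mono-≤ (through-common x y))) (heavy (bad? x y) refl)
      where
      heavy : ∀ b → bad? x y ≡ b → 1ℚ * toℚ (ind b ℕ.* common G x y V₁) ≤ k * toℚ ∣ V₁ ∣ * toℚ (ind b)
      heavy false _ = ℚP.≤-reflexive (trans (ℚP.*-zeroʳ 1ℚ) (sym (ℚP.*-zeroʳ (k * toℚ ∣ V₁ ∣))))
      heavy true  xy-bad = begin
        1ℚ * toℚ (1 ℕ.* common G x y V₁) ≡⟨ trans (ℚP.*-identityˡ _) (cong toℚ (ℕP.*-identityˡ (common G x y V₁))) ⟩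
        toℚ (common G x y V₁)           ≤⟨ no-heavy x y (lookup≡true⇒∈ x∈V₂) (lookup≡true⇒∈ y∈V₃) xy∈E ⟩
        k * toℚ ∣ V₁ ∣                  ≡⟨ ℚP.*-identityʳ _ ⟨
        k * toℚ ∣ V₁ ∣ * 1ℚ             ∎
        where
        x∈V₂ : lookup V₂ x ≡ true
        x∈V₂ = proj₁ (∧≡true⁻ (lookup V₂ x) xy-bad)
        y∈V₃ : lookup V₃ y ≡ true
        y∈V₃ = proj₁ (∧≡true⁻ (lookup V₃ y) (proj₂ (∧≡true⁻ (lookup V₂ x) xy-bad)))
        xy∈E : adj G x y ≡ true
        xy∈E = proj₁ (∧≡true⁻ (adj G x y) (proj₂ (∧≡true⁻ (lookup V₃ y) (proj₂ (∧≡true⁻ (lookup V₂ x) xy-bad)))))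

-- The choice of ε

module Constants (ε' δ : ℚ) (0<ε' : 0ℚ < ε') (0<δ : 0ℚ < δ) where

  1/64 : ℚ
  1/64 = + 1 / 64

  η c ε : ℚ
  η = ε' ⊓ δ ⊓ 1ℚ
  c = η * η * η * η * 1/64
  ε = η * c

  0<η : 0ℚ < η
  0<η = 0<⊓ (0<⊓ 0<ε' 0<δ) (ℚP.positive⁻¹ 1ℚ)
    where
    0<⊓ : ∀ {a b} → 0ℚ < a → 0ℚ < b → 0ℚ < a ⊓ b
    0<⊓ {a} {b} 0<a 0<b with ℚP.≤-total a b
    ... | inj₁ a≤b rewrite ℚP.p≤q⇒p⊓q≡p a≤b = 0<a
    ... | inj₂ b≤a rewrite ℚP.p≥q⇒p⊓q≡q b≤a = 0<b

  0≤η : 0ℚ ≤ η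
  0≤η = ℚP.<⇒≤ 0<η

  η≤ε' : η ≤ ε'
  η≤ε' = ℚP.≤-trans (ℚP.p⊓q≤p (ε' ⊓ δ) 1ℚ) (ℚP.p⊓q≤p ε' δ)

  η≤δ : η ≤ δ
  η≤δ = ℚP.≤-trans (ℚP.p⊓q≤p (ε' ⊓ δ) 1ℚ) (ℚP.p⊓q≤q ε' δ)

  η≤1 : η ≤ 1ℚ
  η≤1 = ℚP.p⊓q≤q (ε' ⊓ δ) 1ℚ

  0<c : 0ℚ < c
  0<c = 0<* (0<* (0<* (0<* 0<η 0<η) 0<η) 0<η) (ℚP.positive⁻¹ 1/64)

  0≤c : 0ℚ ≤ c
  0≤c = ℚP.<⇒≤ 0<c

  0<ε : 0ℚ < ε
  0<ε = 0<* 0<η 0<c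

  0≤ε : 0ℚ ≤ ε
  0≤ε = ℚP.<⇒≤ 0<ε

  ε≤c : ε ≤ c
  ε≤c = ℚP.≤-trans (*-monoʳ-≤ 0≤c η≤1) (ℚP.≤-reflexive (ℚP.*-identityˡ c))

  c≤η/64 : c ≤ η * 1/64
  c≤η/64 = ℚP.≤-trans (*-monoʳ-≤ (ℚP.nonNegative⁻¹ 1/64) (*-monoʳ-≤ 0≤η η³≤1))
                      (ℚP.≤-reflexive (cong (_* 1/64) (ℚP.*-identityˡ η)))
    where
    η³≤1 : η * η * η ≤ 1ℚ
    η³≤1 = *-mono-≤ (0≤* 0≤η 0≤η) (ℚP.nonNegative⁻¹ 1ℚ) (*-mono-≤ 0≤η (ℚP.nonNegative⁻¹ 1ℚ) η≤1 η≤1) η≤1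

  ε≤η/64 : ε ≤ η * 1/64
  ε≤η/64 = ℚP.≤-trans ε≤c c≤η/64

  ε+c≤1 : ε + c ≤ 1ℚ
  ε+c≤1 = ≤-by-difference ((η * 1/64 - ε) + (η * 1/64 - c) + (1ℚ - η) * (+ 2 / 64) + + 62 / 64)
    (identity η ε c) (0≤+ (0≤+ (0≤+ (p≤q⇒0≤q-p ε≤η/64) (p≤q⇒0≤q-p c≤η/64))
                                (0≤* (p≤q⇒0≤q-p η≤1) (ℚP.nonNegative⁻¹ (+ 2 / 64))))
                          (ℚP.nonNegative⁻¹ (+ 62 / 64)))
    where
    identity : ∀ η ε c → 1ℚ - (ε + c) ≡ (η * 1/64 - ε) + (η * 1/64 - c) + (1ℚ - η) * (+ 2 / 64) + + 62 / 64
    identity = solve-∀ ℚ-ring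

  ε≤1 : ε ≤ 1ℚ
  ε≤1 = ℚP.≤-trans (≤-by-difference c (identity ε c) 0≤c) ε+c≤1
    where
    identity : ∀ ε c → ε + c - ε ≡ c
    identity = solve-∀ ℚ-ring

  ε+ε≤1 : ε + ε ≤ 1ℚ
  ε+ε≤1 = ℚP.≤-trans (ℚP.+-monoʳ-≤ ε ε≤c) ε+c≤1

  3ε+c<ε' : ε + ε + ε + c < ε'
  3ε+c<ε' = ℚP.<-≤-trans (<-by-difference (slack + η * (+ 60 / 64)) (identity η ε c)
      (ℚP.+-mono-≤-< 0≤slack (0<* 0<η (ℚP.positive⁻¹ (+ 60 / 64)))))
    η≤ε'
    where
    slack : ℚ
    slack = (η * 1/64 - ε) + (η * 1/64 - ε) + (η * 1/64 - ε) + (η * 1/64 - c)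
    0≤slack : 0ℚ ≤ slack
    0≤slack = 0≤+ (0≤+ (0≤+ (p≤q⇒0≤q-p ε≤η/64) (p≤q⇒0≤q-p ε≤η/64)) (p≤q⇒0≤q-p ε≤η/64)) (p≤q⇒0≤q-p c≤η/64)
    identity : ∀ η ε c → η - (ε + ε + ε + c)
             ≡ ((η * 1/64 - ε) + (η * 1/64 - ε) + (η * 1/64 - ε) + (η * 1/64 - c)) + η * (+ 60 / 64)
    identity = solve-∀ ℚ-ring

  -- ε ≤ c δ turns the error term ε p of regularity into at most c d for every density d ≥ δ p.
  ε≤cδ : ε ≤ c * δ
  ε≤cδ = ℚP.≤-trans (*-monoʳ-≤ 0≤c η≤δ) (ℚP.≤-reflexive (ℚP.*-comm δ c))

  ε≤ε' : ε ≤ ε'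
  ε≤ε' = ℚP.≤-trans (≤-by-difference (ε + ε + c) (identity ε c) (0≤+ (0≤+ 0≤ε 0≤ε) 0≤c)) (ℚP.<⇒≤ 3ε+c<ε')
    where
    identity : ∀ ε c → ε + ε + ε + c - ε ≡ ε + ε + c
    identity = solve-∀ ℚ-ring

  -- β d₂₃ |V₂| |V₃| bounds the non-good edges of (V₂, V₃): (ε + c) d₂₃ |V₂| |V₃| of them start in the
  -- atypical part of V₂, and each typical x ∈ V₂ has at most 2ε (1 + ε) d₂₃ |V₃| of them.
  β : ℚ
  β = (ε + c) + (ε + ε) * (1ℚ + ε)

  4β≤ε'[ε'-ε]δ² : (+ 4 / 1) * β ≤ ε' * (ε' - ε) * (δ * δ)
  4β≤ε'[ε'-ε]δ² = begin
    (+ 4 / 1) * β                        ≤⟨ 4β≤24c ⟩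
    (+ 24 / 1) * c                       ≤⟨ 24c≤η⁴·63/64 ⟩
    η * (η * (+ 63 / 64)) * (η * η)      ≤⟨ *-mono-≤ (0≤* 0≤η 0≤63η/64) (0≤* 0≤δ 0≤δ)
                                              (*-mono-≤ 0≤η (ℚP.≤-trans 0≤63η/64 63η/64≤ε'-ε) η≤ε' 63η/64≤ε'-ε)
                                              (*-mono-≤ 0≤η 0≤δ η≤δ η≤δ) ⟩
    ε' * (ε' - ε) * (δ * δ)              ∎
    where
    open ℚP.≤-Reasoning
    0≤δ : 0ℚ ≤ δ
    0≤δ = ℚP.<⇒≤ 0<δ
    0≤63η/64 : 0ℚ ≤ η * (+ 63 / 64)
    0≤63η/64 = 0≤* 0≤η (ℚP.nonNegative⁻¹ (+ 63 / 64))

    εε≤c : ε * ε ≤ c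
    εε≤c = ℚP.≤-trans (*-monoʳ-≤ 0≤ε ε≤1) (ℚP.≤-trans (ℚP.≤-reflexive (ℚP.*-identityˡ ε)) ε≤c)

    4β≤24c : (+ 4 / 1) * β ≤ (+ 24 / 1) * c
    4β≤24c = ≤-by-difference ((+ 12 / 1) * (c - ε) + (+ 8 / 1) * (c - ε * ε)) (identity ε c)
      (0≤+ (0≤* (ℚP.nonNegative⁻¹ (+ 12 / 1)) (p≤q⇒0≤q-p ε≤c)) (0≤* (ℚP.nonNegative⁻¹ (+ 8 / 1)) (p≤q⇒0≤q-p εε≤c)))
      where
      identity : ∀ ε c → (+ 24 / 1) * c - (+ 4 / 1) * ((ε + c) + (ε + ε) * (1ℚ + ε))
               ≡ (+ 12 / 1) * (c - ε) + (+ 8 / 1) * (c - ε * ε)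
      identity = solve-∀ ℚ-ring

    24c≤η⁴·63/64 : (+ 24 / 1) * c ≤ η * (η * (+ 63 / 64)) * (η * η)
    24c≤η⁴·63/64 = ≤-by-difference (η * η * η * η * (+ 39 / 64)) (identity η)
      (0≤* (0≤* (0≤* (0≤* 0≤η 0≤η) 0≤η) 0≤η) (ℚP.nonNegative⁻¹ (+ 39 / 64)))
      where
      identity : ∀ η → η * (η * (+ 63 / 64)) * (η * η) - (+ 24 / 1) * (η * η * η * η * 1/64)
               ≡ η * η * η * η * (+ 39 / 64)
      identity = solve-∀ ℚ-ring

    63η/64≤ε'-ε : η * (+ 63 / 64) ≤ ε' - ε
    63η/64≤ε'-ε = ≤-by-difference ((ε' - η) + (η * 1/64 - ε)) (identity ε' η ε)
      (0≤+ (p≤q⇒0≤q-p η≤ε') (p≤q⇒0≤q-p ε≤η/64))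
      where
      identity : ∀ ε' η ε → ε' - ε - η * (+ 63 / 64) ≡ (ε' - η) + (η * 1/64 - ε)
      identity = solve-∀ ℚ-ring

module Proof (ε' δ : ℚ) (0<ε' : 0ℚ < ε') (0<δ : 0ℚ < δ) (p : ℚ) (0<p : 0ℚ < p)
  {n} (G : Graph n) (V₁ V₂ V₃ : Subset n)
  (typical : TypicalTriple G (Constants.ε ε' δ 0<ε' 0<δ) p V₁ V₂ V₃)
  (dense : MinDensityAtLeast G (δ * p) V₁ V₂ V₃)
  (no-heavy : NoHeavyEdge G ((+ 4 / 1) * p * p) V₁ V₂ V₃) where

  open Constants ε' δ 0<ε' 0<δ
  open BadEdges G ε' V₁ V₂ V₃

  D₁₂ D₁₃ D₂₃ #V₁ #V₂ #V₃ k θ : ℚ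
  D₁₂ = d G V₁ V₂
  D₁₃ = d G V₁ V₃
  D₂₃ = d G V₂ V₃
  #V₁ = toℚ ∣ V₁ ∣
  #V₂ = toℚ ∣ V₂ ∣
  #V₃ = toℚ ∣ V₃ ∣
  k = (+ 4 / 1) * p * p
  θ = ε' * (D₁₂ * D₁₃ * D₂₃) * #V₂ * #V₃

  reg₂₃ : Regular G ε p V₂ V₃
  reg₂₃ = proj₂ (proj₂ (proj₁ typical))

  S₁ S₂ : Subset n
  S₁ = proj₁ (proj₁ (proj₂ typical))
  S₂ = proj₁ (proj₁ (proj₂ (proj₂ typical)))

  S₁⊆V₁ : S₁ ⊆ V₁
  S₁⊆V₁ = proj₁ (proj₂ (proj₁ (proj₂ typical)))

  small-S₁ : toℚ ∣ S₁ ∣ ≤ ε * #V₁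
  small-S₁ = proj₁ (proj₂ (proj₂ (proj₁ (proj₂ typical))))

  typical₁ : ∀ v → v ∈ V₁ → v ∉ S₁ → TypicalVertex G ε p V₁ V₂ V₃ v
  typical₁ = proj₂ (proj₂ (proj₂ (proj₁ (proj₂ typical))))

  S₂⊆V₂ : S₂ ⊆ V₂
  S₂⊆V₂ = proj₁ (proj₂ (proj₁ (proj₂ (proj₂ typical))))

  small-S₂ : toℚ ∣ S₂ ∣ ≤ ε * #V₂
  small-S₂ = proj₁ (proj₂ (proj₂ (proj₁ (proj₂ (proj₂ typical)))))

  typical₂ : ∀ x → x ∈ V₂ → x ∉ S₂ → TypicalVertex G ε p V₂ V₁ V₃ x
  typical₂ = proj₂ (proj₂ (proj₂ (proj₁ (proj₂ (proj₂ typical)))))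

  0<δp : 0ℚ < δ * p
  0<δp = 0<* 0<δ 0<p

  0<D₁₂ : 0ℚ < D₁₂
  0<D₁₂ = ℚP.<-≤-trans 0<δp (proj₁ dense)

  0<D₁₃ : 0ℚ < D₁₃
  0<D₁₃ = ℚP.<-≤-trans 0<δp (proj₁ (proj₂ dense))

  0<D₂₃ : 0ℚ < D₂₃
  0<D₂₃ = ℚP.<-≤-trans 0<δp (proj₂ (proj₂ dense))

  εp≤c* : ∀ {D} → δ * p ≤ D → ε * p ≤ c * D
  εp≤c* δp≤D = ℚP.≤-trans (*-monoʳ-≤ (ℚP.<⇒≤ 0<p) ε≤cδ)
    (ℚP.≤-trans (ℚP.≤-reflexive (ℚP.*-assoc c δ p)) (*-monoˡ-≤ 0≤c δp≤D))

  s : ℚ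
  s = (ε + ε) * ((1ℚ + ε) * D₂₃ * #V₃)

  badDegree≤s : ∀ x → x ∈ V₂ ─ S₂ → toℚ (badDegree x) ≤ s
  badDegree≤s x x∈V₂─S₂ = typical⇒badDegree≤ 0≤ε 0≤c ε+c≤1 3ε+c<ε' (εp≤c* (proj₁ (proj₂ dense))) 0<D₁₂ 0<D₁₃
    (typical₂ x (proj₁ (x∈p─q⁻ V₂ S₂ x∈V₂─S₂)) (proj₂ (x∈p─q⁻ V₂ S₂ x∈V₂─S₂)))

  ε[D₂₃+p]≤[ε+c]D₂₃ : ε * (D₂₃ + p) ≤ (ε + c) * D₂₃
  ε[D₂₃+p]≤[ε+c]D₂₃ = ≤-by-difference (c * D₂₃ - ε * p) (identity ε c D₂₃ p)
    (p≤q⇒0≤q-p (εp≤c* (proj₂ (proj₂ dense))))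
    where
    identity : ∀ ε c d p → (ε + c) * d - ε * (d + p) ≡ c * d - ε * p
    identity = solve-∀ ℚ-ring

  Bad≤βD₂₃#V₂#V₃ : toℚ Bad ≤ β * D₂₃ * (#V₂ * #V₃)
  Bad≤βD₂₃#V₂#V₃ = begin
    toℚ Bad
      ≤⟨ toℚ-mono-≤ (Bad≤ S₂⊆V₂) ⟩
    toℚ (e G S₂ V₃ ℕ.+ Σbad)
      ≡⟨ toℚ-+ (e G S₂ V₃) Σbad ⟩
    toℚ (e G S₂ V₃) + toℚ Σbad
      ≤⟨ ℚP.+-mono-≤ (Regular⇒e-small-part G 0≤ε (ℚP.<⇒≤ 0<p) ε+ε≤1 reg₂₃ S₂⊆V₂ small-S₂)
                     (sum-over-subset≤ (V₂ ─ S₂) badDegree badDegree≤s) ⟩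
    ε * (D₂₃ + p) * (#V₂ * #V₃) + s * toℚ ∣ V₂ ─ S₂ ∣
      ≤⟨ ℚP.+-mono-≤ (*-monoʳ-≤ (0≤* (0≤toℚ ∣ V₂ ∣) (0≤toℚ ∣ V₃ ∣)) ε[D₂₃+p]≤[ε+c]D₂₃)
                     (*-monoˡ-≤ 0≤s (toℚ-mono-≤ (SubsetP.∣p─q∣≤∣p∣ V₂ S₂))) ⟩
    (ε + c) * D₂₃ * (#V₂ * #V₃) + s * #V₂
      ≡⟨ identity ε c D₂₃ #V₂ #V₃ ⟩
    β * D₂₃ * (#V₂ * #V₃) ∎
    where
    open ℚP.≤-Reasoning
    Σbad : ℕ
    Σbad = sumFin (λ x → ind (lookup (V₂ ─ S₂) x) ℕ.* badDegree x)
    0≤s : 0ℚ ≤ s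
    0≤s = 0≤* (0≤+ 0≤ε 0≤ε) (0≤* (0≤* (0≤+ (ℚP.nonNegative⁻¹ 1ℚ) 0≤ε) (ℚP.<⇒≤ 0<D₂₃)) (0≤toℚ ∣ V₃ ∣))
    identity : ∀ ε c d b b' → (ε + c) * d * (b * b') + (ε + ε) * ((1ℚ + ε) * d * b') * b
             ≡ ((ε + c) + (ε + ε) * (1ℚ + ε)) * d * (b * b')
    identity = solve-∀ ℚ-ring

  0<θ : 0ℚ < θ
  0<θ = 0<* (0<* (0<* 0<ε' (0<* (0<* 0<D₁₂ 0<D₁₃) 0<D₂₃)) (0<d⇒0<∣X∣ G {V₂} {V₃} 0<D₂₃)) (0<d⇒0<∣Y∣ G {V₂} {V₃} 0<D₂₃)

  k#V₁βD₂₃#V₂#V₃≤θ[ε'-ε]#V₁ : k * #V₁ * (β * D₂₃ * (#V₂ * #V₃)) ≤ θ * ((ε' - ε) * #V₁)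
  k#V₁βD₂₃#V₂#V₃≤θ[ε'-ε]#V₁ = begin
    k * #V₁ * (β * D₂₃ * (#V₂ * #V₃))             ≡⟨ identity₁ p #V₁ β D₂₃ #V₂ #V₃ ⟩
    (+ 4 / 1) * β * (p * p) * Q                    ≤⟨ *-monoʳ-≤ 0≤Q (*-monoʳ-≤ (0≤* 0≤p 0≤p) 4β≤ε'[ε'-ε]δ²) ⟩
    ε' * (ε' - ε) * (δ * δ) * (p * p) * Q          ≡⟨ identity₂ ε' ε δ p Q ⟩
    ε' * (ε' - ε) * ((δ * p) * (δ * p)) * Q        ≤⟨ *-monoʳ-≤ 0≤Q (*-monoˡ-≤ (0≤* (ℚP.<⇒≤ 0<ε') (p≤q⇒0≤q-p ε≤ε'))
                                                        (*-mono-≤ (ℚP.<⇒≤ 0<δp) (ℚP.<⇒≤ 0<D₁₃) (proj₁ dense) (proj₁ (proj₂ dense)))) ⟩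
    ε' * (ε' - ε) * (D₁₂ * D₁₃) * Q                ≡⟨ identity₃ ε' ε D₁₂ D₁₃ D₂₃ #V₁ #V₂ #V₃ ⟩
    θ * ((ε' - ε) * #V₁)                           ∎
    where
    open ℚP.≤-Reasoning
    0≤p : 0ℚ ≤ p
    0≤p = ℚP.<⇒≤ 0<p
    Q : ℚ
    Q = #V₁ * D₂₃ * #V₂ * #V₃
    0≤Q : 0ℚ ≤ Q
    0≤Q = 0≤* (0≤* (0≤* (0≤toℚ ∣ V₁ ∣) (ℚP.<⇒≤ 0<D₂₃)) (0≤toℚ ∣ V₂ ∣)) (0≤toℚ ∣ V₃ ∣)
    identity₁ : ∀ p a β d b b' → (+ 4 / 1) * p * p * a * (β * d * (b * b')) ≡ (+ 4 / 1) * β * (p * p) * (a * d * b * b')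
    identity₁ = solve-∀ ℚ-ring
    identity₂ : ∀ ε' ε δ p q → ε' * (ε' - ε) * (δ * δ) * (p * p) * q ≡ ε' * (ε' - ε) * ((δ * p) * (δ * p)) * q
    identity₂ = solve-∀ ℚ-ring
    identity₃ : ∀ ε' ε d₁₂ d₁₃ d₂₃ a b b' → ε' * (ε' - ε) * (d₁₂ * d₁₃) * (a * d₂₃ * b * b')
              ≡ ε' * (d₁₂ * d₁₃ * d₂₃) * b * b' * ((ε' - ε) * a)
    identity₃ = solve-∀ ℚ-ring

  H : Subset n
  H = V₁ ∩ exceeding θ badAt

  small-H : toℚ ∣ H ∣ ≤ (ε' - ε) * #V₁
  small-H = *-cancelʳ-≤ 0<θ (begin
    toℚ ∣ H ∣ * θ                                        ≡⟨ ℚP.*-comm (toℚ ∣ H ∣) θ ⟩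
    θ * toℚ ∣ H ∣                                        ≤⟨ markov V₁ badAt θ ⟩
    toℚ (sumFin (λ v → ind (lookup V₁ v) ℕ.* badAt v))  ≤⟨ sum-badAt≤ {k} no-heavy ⟩
    k * #V₁ * toℚ Bad                                    ≤⟨ *-monoˡ-≤ 0≤k#V₁ Bad≤βD₂₃#V₂#V₃ ⟩
    k * #V₁ * (β * D₂₃ * (#V₂ * #V₃))                    ≤⟨ k#V₁βD₂₃#V₂#V₃≤θ[ε'-ε]#V₁ ⟩
    θ * ((ε' - ε) * #V₁)                                 ≡⟨ ℚP.*-comm θ _ ⟩
    (ε' - ε) * #V₁ * θ                                   ∎)
    where
    open ℚP.≤-Reasoning
    0≤k#V₁ : 0ℚ ≤ k * #V₁
    0≤k#V₁ = 0≤* (0≤* (0≤* (ℚP.nonNegative⁻¹ (+ 4 / 1)) (ℚP.<⇒≤ 0<p)) (ℚP.<⇒≤ 0<p)) (0≤toℚ ∣ V₁ ∣)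

  X : Subset n
  X = S₁ ∪ H

  X⊆V₁ : X ⊆ V₁
  X⊆V₁ v∈X = [ S₁⊆V₁ , (λ v∈H → proj₁ (SubsetP.x∈p∩q⁻ V₁ (exceeding θ badAt) v∈H)) ] (SubsetP.x∈p∪q⁻ S₁ H v∈X)

  small-X : toℚ ∣ X ∣ ≤ ε' * #V₁
  small-X = begin
    toℚ ∣ X ∣                   ≤⟨ toℚ-mono-≤ (∣p∪q∣≤∣p∣+∣q∣ S₁ H) ⟩
    toℚ (∣ S₁ ∣ ℕ.+ ∣ H ∣)      ≡⟨ toℚ-+ (∣ S₁ ∣) (∣ H ∣) ⟩
    toℚ (∣ S₁ ∣) + toℚ (∣ H ∣)  ≤⟨ ℚP.+-mono-≤ small-S₁ small-H ⟩
    ε * #V₁ + (ε' - ε) * #V₁    ≡⟨ identity ε ε' #V₁ ⟩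
    ε' * #V₁                    ∎
    where
    open ℚP.≤-Reasoning
    identity : ∀ ε ε' a → ε * a + (ε' - ε) * a ≡ ε' * a
    identity = solve-∀ ℚ-ring

  good-outside-X : ∀ v → v ∈ V₁ → v ∉ X → GoodVertex G ε' p V₁ V₂ V₃ v
  good-outside-X v v∈V₁ v∉X =
    TypicalVertex-mono G ε≤ε' (ℚP.<⇒≤ 0<p) {V₁} {V₂} {V₃} (typical₁ v v∈V₁ (λ v∈S₁ → v∉X (SubsetP.x∈p∪q⁺ (inj₁ v∈S₁)))) ,
    ∉exceeding⇒≤ {θ = θ} {f = badAt} (λ v∈E → v∉X (SubsetP.x∈p∪q⁺ (inj₂ (SubsetP.x∈p∩q⁺ (v∈V₁ , v∈E)))))

  exceptional-set : AllButAtMost ε' V₁ (GoodVertex G ε' p V₁ V₂ V₃)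
  exceptional-set = X , X⊆V₁ , small-X , good-outside-X

proposition2p13 : ∀ (ε' δ : ℚ) → 0ℚ < ε' → 0ℚ < δ →
    Σ ℚ λ ε → 0ℚ < ε ×
      (∀ (p : ℚ) → 0ℚ < p → ∀ (n : ℕ) (G : Graph n) (V₁ V₂ V₃ : Subset n) →
        Disjoint V₁ V₂ → Disjoint V₁ V₃ → Disjoint V₂ V₃ →
        TypicalTriple G ε p V₁ V₂ V₃ →
        MinDensityAtLeast G (δ * p) V₁ V₂ V₃ →
        NoHeavyEdge G ((+ 4 / 1) * p * p) V₁ V₂ V₃ →
        AllButAtMost ε' V₁ (GoodVertex G ε' p V₁ V₂ V₃))
proposition2p13 ε' δ 0<ε' 0<δ =
  Constants.ε ε' δ 0<ε' 0<δ , Constants.0<ε ε' δ 0<ε' 0<δ ,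
  λ p 0<p n G V₁ V₂ V₃ _ _ _ typical dense no-heavy →
    Proof.exceptional-set ε' δ 0<ε' 0<δ p 0<p G V₁ V₂ V₃ typical dense no-heavy
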